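{- For every integer $n\ge 1$, $$\mathrm{LB}_n(112)=\mathrm{RS}_n(112)=\mathrm{LB}_n(122)=\sum_{t\ge 0}\begin{bmatrix} n-1\\ t\end{bmatrix}_q .$$
   Context: A restricted growth function (RGF) of length $n$ is a sequence $w=w_1\dots w_n$ of positive integers with $w_1=1$ and $w_i\le 1+\max\{w_1,\dots,w_{i-1}\}$ for $i\ge 2$ ($R_0$ consists of the empty word); $R_n$ is the set of RGFs of length $n$. The standardization of a word replaces every occurrence of its smallest letter by $1$, of its next smallest letter by $2$, and so on. An RGF $w$ contains an RGF $v$ if some subword (subsequence, not necessarily consecutive) of $w$ standardizes to $v$; otherwise $w$ avoids $v$. $R_n(v)$ is the set of $w\in R_n$ avoiding $v$. For a word $w$ and position $j$: $\mathrm{lb}(w_j)$ is the number of distinct values $w_i$ with $i<j$ and $w_i>w_j$; $\mathrm{rs}(w_j)$ is the number of distinct values $w_i$ with $i>j$ and $w_i<w_j$; $\mathrm{lb}(w)=\sum_j \mathrm{lb}(w_j)$, $\mathrm{rs}(w)=\sum_j\mathrm{rs}(w_j)$. Then $\mathrm{LB}_n(v)=\sum_{w\in R_n(v)}q^{\mathrm{lb}(w)}$ and $\mathrm{RS}_n(v)=\sum_{w\in R_n(v)}q^{\mathrm{rs}(w)}$. Here $[m]_q=1+q+\dots+q^{m-1}$, $[m]_q!=[1]_q\cdots[m]_q$, $\begin{bmatrix} n\\ k\end{bmatrix}_q=\frac{[n]_q!}{[k]_q![n-k]_q!}$ for $0\le k\le n$, and it is $0$ if $k<0$ or $k>n$.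 -}

module Defs where

open import Data.Nat using (ℕ; zero; suc; _+_; _⊔_; _≤ᵇ_; _<ᵇ_; _≡ᵇ_)
open import Data.Bool using (Bool; true; false; _∧_)
open import Data.List using (List; []; _∷_; _++_; [_]; map; concatMap; length; filterᵇ; deduplicateᵇ; upTo; replicate)
open import Data.Bool.ListAction using (any)
open import Relation.Binary.PropositionalEquality using (_≡_)

-- Words are lists of natural numbers (letters are positive integers).
Word : Set
Word = List ℕ

-- RGF test: w₁ = 1 and wᵢ ≤ 1 + max{w₁..w_{i-1}}, all letters ≥ 1.
-- Running maximum starts at 0, so the first letter must be exactly 1.
isRGF-go : ℕ → Word → Bool
isRGF-go m [] = true
isRGF-go m (x ∷ xs) = (1 ≤ᵇ x) ∧ (x ≤ᵇ suc m) ∧ isRGF-go (m ⊔ x) xs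

isRGF : Word → Bool
isRGF = isRGF-go 0

words : ℕ → ℕ → List Word
words zero m = [] ∷ []
words (suc n) m = concatMap (λ w → map (λ x → x ∷ w) (map suc (upTo m))) (words n m)

-- R_n : RGFs of length n (every letter of an RGF of length n is ≤ n)
R : ℕ → List Word
R n = filterᵇ isRGF (words n n)

distinct : Word → List ℕ
distinct = deduplicateᵇ _≡ᵇ_

std : Word → Word
std w = map (λ x → suc (length (filterᵇ (λ y → y <ᵇ x) (distinct w)))) w

subwords : Word → List Word
subwords [] = [] ∷ []
subwords (x ∷ xs) = map (x ∷_) (subwords xs) ++ subwords xs

eqWord : Word → Word → Bool
eqWord [] [] = true
eqWord [] (_ ∷ _) = false
eqWord (_ ∷ _) [] = false
eqWord (x ∷ xs) (y ∷ ys) = (x ≡ᵇ y) ∧ eqWord xs ys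

contains : Word → Word → Bool
contains w v = any (λ s → eqWord (std s) v) (subwords w)

avoids : Word → Word → Bool
avoids w v with contains w v
... | true = false
... | false = true

Ravoid : ℕ → Word → List Word
Ravoid n v = filterᵇ (λ w → avoids w v) (R n)

lb-go : Word → Word → ℕ
lb-go pre [] = 0
lb-go pre (x ∷ xs) = length (distinct (filterᵇ (λ y → x <ᵇ y) pre)) + lb-go (pre ++ [ x ]) xs

lb : Word → ℕ
lb = lb-go []

rs : Word → ℕ
rs [] = 0
rs (x ∷ xs) = length (distinct (filterᵇ (λ y → y <ᵇ x) xs)) + rs xs

-- Polynomials in q with ℕ coefficients, as coefficient lists (constant term first)

Poly : Set
Poly = List ℕ

_⊕_ : Poly → Poly → Poly
[] ⊕ q = q
(a ∷ p) ⊕ [] = a ∷ p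
(a ∷ p) ⊕ (b ∷ q) = (a + b) ∷ (p ⊕ q)

shiftBy : ℕ → Poly → Poly
shiftBy k p = replicate k 0 ++ p

monomial : ℕ → Poly
monomial k = shiftBy k (1 ∷ [])

coeff : Poly → ℕ → ℕ
coeff [] k = 0
coeff (a ∷ p) zero = a
coeff (a ∷ p) (suc k) = coeff p k

infix 4 _≈P_
_≈P_ : Poly → Poly → Set
p ≈P r = ∀ k → coeff p k ≡ coeff r k

genPoly : (Word → ℕ) → List Word → Poly
genPoly stat [] = []
genPoly stat (w ∷ ws) = monomial (stat w) ⊕ genPoly stat ws

LB : ℕ → Word → Poly
LB n v = genPoly lb (Ravoid n v)

RS : ℕ → Word → Poly
RS n v = genPoly rs (Ravoid n v)

-- Gaussian binomial [n choose k]_q via the q-Pascal recurrence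
-- [n+1 choose k+1] = [n choose k] + q^{k+1} [n choose k+1];  0 for k > n.
qbinom : ℕ → ℕ → Poly
qbinom zero zero = 1 ∷ []
qbinom zero (suc k) = []
qbinom (suc n) zero = 1 ∷ []
qbinom (suc n) (suc k) = qbinom n k ⊕ shiftBy (suc k) (qbinom n (suc k))

-- Σ_{t=0}^{m} [n choose t]_q  (terms with t > n vanish)
sumQbinom : ℕ → ℕ → Poly
sumQbinom n zero = qbinom n 0
sumQbinom n (suc m) = qbinom n (suc m) ⊕ sumQbinom n m

w112 w122 : Word
w112 = 1 ∷ 1 ∷ 2 ∷ []
w122 = 1 ∷ 2 ∷ 2 ∷ []

-- An RGF avoids 112 iff it is 1 2 ⋯ k u with u weakly decreasing over {1, …, k}, and it avoids 122 iff
-- each letter is 1 or a new maximum. On 1 ⋯ k u, appending a letter z to u changes lb and rs by amounts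
-- depending only on z, the last letter of u and the length of u, so splitting off last letters shows that
-- for either statistic the weakly decreasing u of length r + 1 contribute [k + r, r + 1]_q (by the two
-- q-Pascal rules); summing over k gives Σ_t [n − 1, t]_q. For 122, each further letter is either 1, costing
-- the current maximum minus one, or a new maximum, costing nothing; from a prefix with maximum c + 1 this
-- gives Σ_t q^(c t) [r, t]_q, which for c = 0 is again Σ_t [n − 1, t]_q. Containment of a pattern of length
-- 3 only depends on the order types of triples, which are finitely many.

module Submission where

open import Defs
open import Algebra.Bundles using (CommutativeMonoid)
open import Data.Bool using (Bool; true; false; T; T?; _∧_; _∨_; not; if_then_else_)
open import Data.Bool.Properties as Bool
  using (∧-assoc; ∧-identityʳ; ∧-zeroʳ; ∨-assoc; ∨-comm; ∨-identityʳ; ∨-zeroʳ; ∨-commutativeMonoid)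
open import Data.Bool.ListAction using (any)
open import Data.Empty using (⊥-elim)
open import Data.Fin using (Fin; toℕ)
open import Data.Fin.Patterns using (0F; 1F; 2F)
open import Data.Fin.Properties using (all?)
open import Data.List using (List; []; _∷_; _++_; [_]; map; concatMap; length; filter; filterᵇ; upTo; applyUpTo)
open import Data.List.Properties
  using (length-++; length-map; map-∘; map-cong; ++-assoc; ++-identityʳ; filter-++; filter-accept; filter-reject)
open import Data.List.Relation.Unary.All as All using (All; []; _∷_)
open import Data.Nat using (ℕ; zero; suc; _+_; _*_; _∸_; _⊔_; _≤_; _<_; z≤n; s≤s; z<s; _≤ᵇ_; _<ᵇ_; _≡ᵇ_)
open import Data.Nat.Properties
open import Data.Product using (_×_; _,_; proj₁; proj₂)
open import Data.Sum using (inj₁; inj₂)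
open import Function using (_∘_)
open import Level using (Level)
open import Relation.Binary.Definitions using (tri<; tri≈; tri>)
open import Relation.Nullary using (¬_; yes; no; does; from-yes)
open import Relation.Unary using (Pred; Decidable)
open import Relation.Binary.PropositionalEquality hiding ([_])
open ≡-Reasoning

open import Algebra.Properties.CommutativeSemigroup +-commutativeSemigroup
  using () renaming (interchange to +-interchange; x∙yz≈y∙xz to +-x∙yz≈y∙xz)
open import Algebra.Properties.CommutativeSemigroup (CommutativeMonoid.commutativeSemigroup ∨-commutativeMonoid)
  using () renaming (x∙yz≈y∙xz to ∨-x∙yz≈y∙xz; xy∙z≈y∙zx to ∨-xy∙z≈y∙zx)

private variable
  ℓ : Level
  A B : Set

T⇒≡true : ∀ {b} → T b → b ≡ true
T⇒≡true {true} _ = refl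

¬T⇒≡false : ∀ {b} → ¬ T b → b ≡ false
¬T⇒≡false {false} _ = refl
¬T⇒≡false {true} ¬t = ⊥-elim (¬t _)

≡true⇒T : ∀ {b} → b ≡ true → T b
≡true⇒T refl = _

∧-true⁻¹ : ∀ {a b} → a ∧ b ≡ true → a ≡ true × b ≡ true
∧-true⁻¹ {true} {true} _ = refl , refl

≡ᵇ-refl : ∀ n → (n ≡ᵇ n) ≡ true
≡ᵇ-refl n = T⇒≡true (≡⇒≡ᵇ n n refl)

≡ᵇ-false : ∀ {m n} → m ≢ n → (m ≡ᵇ n) ≡ false
≡ᵇ-false {m} {n} m≢n = ¬T⇒≡false (m≢n ∘ ≡ᵇ⇒≡ m n)

≡ᵇ-true⁻¹ : ∀ {m n} → (m ≡ᵇ n) ≡ true → m ≡ n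
≡ᵇ-true⁻¹ {m} {n} = ≡ᵇ⇒≡ m n ∘ ≡true⇒T

≡ᵇ-false⁻¹ : ∀ {m n} → (m ≡ᵇ n) ≡ false → m ≢ n
≡ᵇ-false⁻¹ {m} {n} m≢ᵇn m≡n = subst T m≢ᵇn (≡⇒≡ᵇ m n m≡n)

<ᵇ-true : ∀ {m n} → m < n → (m <ᵇ n) ≡ true
<ᵇ-true = T⇒≡true ∘ <⇒<ᵇ

<ᵇ-false : ∀ {m n} → n ≤ m → (m <ᵇ n) ≡ false
<ᵇ-false {m} {n} n≤m = ¬T⇒≡false (λ t → <⇒≱ (<ᵇ⇒< m n t) n≤m)

<ᵇ-true⁻¹ : ∀ {m n} → (m <ᵇ n) ≡ true → m < n
<ᵇ-true⁻¹ {m} {n} = <ᵇ⇒< m n ∘ ≡true⇒T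

<ᵇ-false⁻¹ : ∀ {m n} → (m <ᵇ n) ≡ false → n ≤ m
<ᵇ-false⁻¹ {m} {n} m≮ᵇn = ≮⇒≥ (λ m<n → subst T m≮ᵇn (<⇒<ᵇ m<n))

≤ᵇ-true : ∀ {m n} → m ≤ n → (m ≤ᵇ n) ≡ true
≤ᵇ-true = T⇒≡true ∘ ≤⇒≤ᵇ

≤ᵇ-false : ∀ {m n} → n < m → (m ≤ᵇ n) ≡ false
≤ᵇ-false {m} {n} n<m = ¬T⇒≡false (λ t → <⇒≱ n<m (≤ᵇ⇒≤ m n t))

≤ᵇ-true⁻¹ : ∀ {m n} → (m ≤ᵇ n) ≡ true → m ≤ n
≤ᵇ-true⁻¹ {m} {n} = ≤ᵇ⇒≤ m n ∘ ≡true⇒T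

-- A power series in q is its coefficient function; shift s multiplies by q^s and δ a is q^a.
Series : Set
Series = ℕ → ℕ

when : Bool → ℕ → ℕ
when true n = n
when false n = 0

δ : ℕ → Series
δ a K = when (a ≡ᵇ K) 1

shift : ℕ → Series → Series
shift zero f K = f K
shift (suc s) f zero = 0
shift (suc s) f (suc K) = shift s f K

when-∧ : ∀ a b n → when (a ∧ b) n ≡ when a (when b n)
when-∧ true b n = refl
when-∧ false b n = refl

when-zero : ∀ b → when b 0 ≡ 0
when-zero true = refl
when-zero false = refl

when-<ᵇ-suc : ∀ y i n → when (y <ᵇ suc i) n ≡ when (i ≡ᵇ y) n + when (y <ᵇ i) n
when-<ᵇ-suc y i n with <-cmp i y
... | tri< i<y _ _ rewrite <ᵇ-false {y} {suc i} i<y | ≡ᵇ-false (<⇒≢ i<y) | <ᵇ-false {y} {i} (<⇒≤ i<y) = refl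
... | tri≈ _ refl _ rewrite <ᵇ-true (n<1+n i) | ≡ᵇ-refl i | <ᵇ-false {i} {i} ≤-refl = sym (+-identityʳ n)
... | tri> _ _ y<i rewrite <ᵇ-true (m<n⇒m<1+n y<i) | ≡ᵇ-false (>⇒≢ y<i) | <ᵇ-true y<i = refl

shift-cong : ∀ s {f g : Series} → f ≗ g → shift s f ≗ shift s g
shift-cong zero f≗g K = f≗g K
shift-cong (suc s) f≗g zero = refl
shift-cong (suc s) f≗g (suc K) = shift-cong s f≗g K

shift-zero : ∀ s K → shift s (λ _ → 0) K ≡ 0
shift-zero zero K = refl
shift-zero (suc s) zero = refl
shift-zero (suc s) (suc K) = shift-zero s K

shift-+ : ∀ s (f g : Series) K → shift s (λ K′ → f K′ + g K′) K ≡ shift s f K + shift s g K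
shift-+ zero f g K = refl
shift-+ (suc s) f g zero = refl
shift-+ (suc s) f g (suc K) = shift-+ s f g K

shift-shift : ∀ s t (f : Series) K → shift s (shift t f) K ≡ shift (s + t) f K
shift-shift zero t f K = refl
shift-shift (suc s) t f zero = refl
shift-shift (suc s) t f (suc K) = shift-shift s t f K

shift-regroup : ∀ s t s′ t′ → s + t ≡ s′ + t′ → ∀ (f : Series) K → shift s (shift t f) K ≡ shift s′ (shift t′ f) K
shift-regroup s t s′ t′ eq f K = trans (shift-shift s t f K)
    (trans (cong (λ u → shift u f K) eq) (sym (shift-shift s′ t′ f K)))

shift-δ : ∀ s a K → shift s (δ a) K ≡ δ (s + a) K
shift-δ zero a K = refl
shift-δ (suc s) a zero = refl
shift-δ (suc s) a (suc K) = shift-δ s a K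

when-shift : ∀ b s (f : Series) K → when b (shift s f K) ≡ shift s (λ K′ → when b (f K′)) K
when-shift true s f K = refl
when-shift false s f K = sym (shift-zero s K)

coeff-⊕ : ∀ p r K → coeff (p ⊕ r) K ≡ coeff p K + coeff r K
coeff-⊕ [] r K = refl
coeff-⊕ (a ∷ p) [] K = sym (+-identityʳ _)
coeff-⊕ (a ∷ p) (b ∷ r) zero = refl
coeff-⊕ (a ∷ p) (b ∷ r) (suc K) = coeff-⊕ p r K

coeff-shiftBy : ∀ s p K → coeff (shiftBy s p) K ≡ shift s (coeff p) K
coeff-shiftBy zero p K = refl
coeff-shiftBy (suc s) p zero = refl
coeff-shiftBy (suc s) p (suc K) = coeff-shiftBy s p K

coeff-one : ∀ K → coeff (1 ∷ []) K ≡ δ 0 K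
coeff-one zero = refl
coeff-one (suc K) = refl

coeff-monomial : ∀ a K → coeff (monomial a) K ≡ δ a K
coeff-monomial a K = begin
  coeff (monomial a) K   ≡⟨ coeff-shiftBy a (1 ∷ []) K ⟩
  shift a (coeff (1 ∷ [])) K ≡⟨ shift-cong a coeff-one K ⟩
  shift a (δ 0) K        ≡⟨ shift-δ a 0 K ⟩
  δ (a + 0) K            ≡⟨ cong (λ b → δ b K) (+-identityʳ a) ⟩
  δ a K                  ∎

sumList : List A → (A → ℕ) → ℕ
sumList [] f = 0
sumList (x ∷ xs) f = f x + sumList xs f

sumRange : ℕ → (ℕ → ℕ) → ℕ
sumRange zero f = 0
sumRange (suc n) f = sumRange n f + f n

coeff-genPoly : ∀ (stat : Word → ℕ) ws K → coeff (genPoly stat ws) K ≡ sumList ws (λ w → δ (stat w) K)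
coeff-genPoly stat [] K = refl
coeff-genPoly stat (w ∷ ws) K = begin
  coeff (monomial (stat w) ⊕ genPoly stat ws) K ≡⟨ coeff-⊕ (monomial (stat w)) (genPoly stat ws) K ⟩
  coeff (monomial (stat w)) K + coeff (genPoly stat ws) K
    ≡⟨ cong₂ _+_ (coeff-monomial (stat w) K) (coeff-genPoly stat ws K) ⟩
  δ (stat w) K + sumList ws (λ w → δ (stat w) K) ∎

sumList-cong : ∀ (xs : List A) {f g : A → ℕ} → f ≗ g → sumList xs f ≡ sumList xs g
sumList-cong [] f≗g = refl
sumList-cong (x ∷ xs) f≗g = cong₂ _+_ (f≗g x) (sumList-cong xs f≗g)

sumList-zero : ∀ (xs : List A) → sumList xs (λ _ → 0) ≡ 0
sumList-zero [] = refl
sumList-zero (x ∷ xs) = sumList-zero xs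

sumList-+ : ∀ (xs : List A) (f g : A → ℕ) → sumList xs (λ x → f x + g x) ≡ sumList xs f + sumList xs g
sumList-+ [] f g = refl
sumList-+ (x ∷ xs) f g = trans (cong (f x + g x +_) (sumList-+ xs f g)) (+-interchange (f x) (g x) _ _)

sumList-++ : ∀ (xs ys : List A) f → sumList (xs ++ ys) f ≡ sumList xs f + sumList ys f
sumList-++ [] ys f = refl
sumList-++ (x ∷ xs) ys f = trans (cong (f x +_) (sumList-++ xs ys f)) (sym (+-assoc (f x) _ _))

sumList-map : ∀ (g : A → B) xs f → sumList (map g xs) f ≡ sumList xs (f ∘ g)
sumList-map g [] f = refl
sumList-map g (x ∷ xs) f = cong (f (g x) +_) (sumList-map g xs f)

sumList-concatMap : ∀ (g : A → List B) xs f → sumList (concatMap g xs) f ≡ sumList xs (λ x → sumList (g x) f)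
sumList-concatMap g [] f = refl
sumList-concatMap g (x ∷ xs) f = trans (sumList-++ (g x) (concatMap g xs) f)
    (cong (sumList (g x) f +_) (sumList-concatMap g xs f))

sumList-filterᵇ : ∀ (p : A → Bool) xs f → sumList (filterᵇ p xs) f ≡ sumList xs (λ x → when (p x) (f x))
sumList-filterᵇ p [] f = refl
sumList-filterᵇ p (x ∷ xs) f with p x
... | true = cong (f x +_) (sumList-filterᵇ p xs f)
... | false = sumList-filterᵇ p xs f

sumList-shift : ∀ (xs : List A) s (F : A → Series) K →
  sumList xs (λ x → shift s (F x) K) ≡ shift s (λ K′ → sumList xs (λ x → F x K′)) K
sumList-shift xs zero F K = refl
sumList-shift xs (suc s) F zero = sumList-zero xs
sumList-shift xs (suc s) F (suc K) = sumList-shift xs s F K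

sumRange-cong : ∀ n {f g : ℕ → ℕ} → (∀ i → i < n → f i ≡ g i) → sumRange n f ≡ sumRange n g
sumRange-cong zero f≗g = refl
sumRange-cong (suc n) f≗g = cong₂ _+_ (sumRange-cong n (λ i i<n → f≗g i (m<n⇒m<1+n i<n))) (f≗g n ≤-refl)

sumRange-zero : ∀ n → sumRange n (λ _ → 0) ≡ 0
sumRange-zero zero = refl
sumRange-zero (suc n) = cong (_+ 0) (sumRange-zero n)

sumRange-+ : ∀ n (f g : ℕ → ℕ) → sumRange n (λ i → f i + g i) ≡ sumRange n f + sumRange n g
sumRange-+ zero f g = refl
sumRange-+ (suc n) f g = trans (cong (_+ (f n + g n)) (sumRange-+ n f g)) (+-interchange (sumRange n f) _ _ _)

sumRange-unfoldˡ : ∀ n f → sumRange (suc n) f ≡ f 0 + sumRange n (f ∘ suc)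
sumRange-unfoldˡ zero f = +-comm 0 (f 0)
sumRange-unfoldˡ (suc n) f = trans (cong (_+ f (suc n)) (sumRange-unfoldˡ n f)) (+-assoc (f 0) _ _)

sumRange-shift : ∀ n s (F : ℕ → Series) K →
  sumRange n (λ i → shift s (F i) K) ≡ shift s (λ K′ → sumRange n (λ i → F i K′)) K
sumRange-shift n zero F K = refl
sumRange-shift n (suc s) F zero = sumRange-zero n
sumRange-shift n (suc s) F (suc K) = sumRange-shift n s F K

sumRange-swap : ∀ m n (f : ℕ → ℕ → ℕ) → sumRange m (λ i → sumRange n (f i))
    ≡ sumRange n (λ j → sumRange m (λ i → f i j))
sumRange-swap zero n f = sym (sumRange-zero n)
sumRange-swap (suc m) n f = trans (cong (_+ sumRange n (f m)) (sumRange-swap m n f)) (sym (sumRange-+ n _ (f m)))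

sumList-sumRange : ∀ (xs : List A) n (f : A → ℕ → ℕ) → sumList xs (λ x → sumRange n (f x))
    ≡ sumRange n (λ i → sumList xs (λ x → f x i))
sumList-sumRange xs zero f = sumList-zero xs
sumList-sumRange xs (suc n) f = trans (sumList-+ xs _ (λ x → f x n))
    (cong (_+ sumList xs (λ x → f x n)) (sumList-sumRange xs n f))

sumList-applyUpTo : ∀ n (g : ℕ → A) f → sumList (applyUpTo g n) f ≡ sumRange n (f ∘ g)
sumList-applyUpTo zero g f = refl
sumList-applyUpTo (suc n) g f = trans (cong (f (g 0) +_) (sumList-applyUpTo n (g ∘ suc) f))
    (sym (sumRange-unfoldˡ n (f ∘ g)))

sumRange-pick : ∀ n j (f : ℕ → ℕ) → j < n → sumRange n (λ i → when (i ≡ᵇ j) (f i)) ≡ f j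
sumRange-pick (suc n) j f j<1+n with j ≟ n
... | yes refl = begin
  sumRange n (λ i → when (i ≡ᵇ j) (f i)) + when (j ≡ᵇ j) (f j)
    ≡⟨ cong₂ _+_ (sumRange-cong n (λ i i<j → cong (λ b → when b (f i)) (≡ᵇ-false (<⇒≢ i<j))))
      (cong (λ b → when b (f j)) (≡ᵇ-refl j)) ⟩
  sumRange n (λ _ → 0) + f j ≡⟨ cong (_+ f j) (sumRange-zero n) ⟩
  f j ∎
... | no j≢n = begin
  sumRange n (λ i → when (i ≡ᵇ j) (f i)) + when (n ≡ᵇ j) (f n)
    ≡⟨ cong₂ _+_ (sumRange-pick n j f (≤∧≢⇒< (≤-pred j<1+n) j≢n)) (cong (λ b → when b (f n)) (≡ᵇ-false (j≢n ∘ sym))) ⟩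
  f j + 0 ≡⟨ +-identityʳ (f j) ⟩
  f j ∎

sumRange-truncate : ∀ n k (f : ℕ → ℕ) → k ≤ n → (∀ i → k ≤ i → f i ≡ 0) → sumRange n f ≡ sumRange k f
sumRange-truncate n k f k≤n f≡0 with m≤n⇒m<n∨m≡n k≤n
... | inj₂ refl = refl
sumRange-truncate (suc n) k f k≤n f≡0 | inj₁ k<1+n =
  trans (cong₂ _+_ (sumRange-truncate n k f (≤-pred k<1+n) f≡0) (f≡0 n (≤-pred k<1+n))) (+-identityʳ _)

sumWords : ℕ → ℕ → (Word → ℕ) → ℕ
sumWords N r f = sumList (words r N) f

module _ {N : ℕ} where

  sumWords-[] : ∀ f → sumWords N 0 f ≡ f []
  sumWords-[] f = +-identityʳ (f [])

  sumWords-∷ : ∀ r f → sumWords N (suc r) f ≡ sumRange N (λ i → sumWords N r (λ w → f (suc i ∷ w)))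
  sumWords-∷ r f = begin
    sumList (concatMap (λ w → map (_∷ w) (map suc (upTo N))) (words r N)) f
      ≡⟨ sumList-concatMap _ (words r N) f ⟩
    sumList (words r N) (λ w → sumList (map (_∷ w) (map suc (upTo N))) f)
      ≡⟨ sumList-cong (words r N) (λ w → begin
           sumList (map (_∷ w) (map suc (upTo N))) f ≡⟨ sumList-map (_∷ w) (map suc (upTo N)) f ⟩
           sumList (map suc (upTo N)) (λ x → f (x ∷ w)) ≡⟨ sumList-map suc (upTo N) _ ⟩
           sumList (upTo N) (λ i → f (suc i ∷ w)) ≡⟨ sumList-applyUpTo N (λ i → i) _ ⟩
           sumRange N (λ i → f (suc i ∷ w)) ∎) ⟩
    sumList (words r N) (λ w → sumRange N (λ i → f (suc i ∷ w)))
      ≡⟨ sumList-sumRange (words r N) N (λ w i → f (suc i ∷ w)) ⟩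
    sumRange N (λ i → sumWords N r (λ w → f (suc i ∷ w))) ∎

  sumWords-cong : ∀ r {f g : Word → ℕ} → (∀ w → length w ≡ r → f w ≡ g w) → sumWords N r f ≡ sumWords N r g
  sumWords-cong zero {f} {g} f≗g = begin
    sumWords N 0 f ≡⟨ sumWords-[] f ⟩
    f []           ≡⟨ f≗g [] refl ⟩
    g []           ≡⟨ sumWords-[] g ⟨
    sumWords N 0 g ∎
  sumWords-cong (suc r) {f} {g} f≗g = begin
    sumWords N (suc r) f ≡⟨ sumWords-∷ r f ⟩
    sumRange N (λ i → sumWords N r (λ w → f (suc i ∷ w)))
      ≡⟨ sumRange-cong N (λ i _ → sumWords-cong r (λ w |w| → f≗g (suc i ∷ w) (cong suc |w|))) ⟩
    sumRange N (λ i → sumWords N r (λ w → g (suc i ∷ w))) ≡⟨ sumWords-∷ r g ⟨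
    sumWords N (suc r) g ∎

  sumWords-∷ʳ : ∀ r f → sumWords N (suc r) f ≡ sumRange N (λ i → sumWords N r (λ w → f (w ++ [ suc i ])))
  sumWords-∷ʳ zero f = trans (sumWords-∷ zero f)
    (sumRange-cong N (λ i _ → trans (sumWords-[] (λ w → f (suc i ∷ w)))
        (sym (sumWords-[] (λ w → f (w ++ [ suc i ]))))))
  sumWords-∷ʳ (suc r) f = begin
    sumWords N (suc (suc r)) f ≡⟨ sumWords-∷ (suc r) f ⟩
    sumRange N (λ j → sumWords N (suc r) (λ w → f (suc j ∷ w)))
      ≡⟨ sumRange-cong N (λ j _ → sumWords-∷ʳ r (λ w → f (suc j ∷ w))) ⟩
    sumRange N (λ j → sumRange N (λ i → sumWords N r (λ w → f (suc j ∷ w ++ [ suc i ]))))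
      ≡⟨ sumRange-swap N N _ ⟩
    sumRange N (λ i → sumRange N (λ j → sumWords N r (λ w → f (suc j ∷ w ++ [ suc i ]))))
      ≡⟨ sumRange-cong N (λ i _ → sumWords-∷ r (λ w → f (w ++ [ suc i ]))) ⟨
    sumRange N (λ i → sumWords N (suc r) (λ w → f (w ++ [ suc i ]))) ∎

  sumWords-+ : ∀ r f g → sumWords N r (λ w → f w + g w) ≡ sumWords N r f + sumWords N r g
  sumWords-+ r = sumList-+ (words r N)

  sumWords-zero : ∀ r → sumWords N r (λ _ → 0) ≡ 0
  sumWords-zero r = sumList-zero (words r N)

  sumWords-when : ∀ r b f → sumWords N r (λ w → when b (f w)) ≡ when b (sumWords N r f)
  sumWords-when r true f = refl
  sumWords-when r false f = sumWords-zero r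

  sumWords-shift : ∀ r s (F : Word → Series) K →
    sumWords N r (λ w → shift s (F w) K) ≡ shift s (λ K′ → sumWords N r (λ w → F w K′)) K
  sumWords-shift r = sumList-shift (words r N)

gauss : ℕ → ℕ → Series
gauss n k = coeff (qbinom n k)

gaussSum : ℕ → ℕ → Series
gaussSum n m = coeff (sumQbinom n m)

gaussSum-suc : ∀ n m K → gaussSum n (suc m) K ≡ gauss n (suc m) K + gaussSum n m K
gaussSum-suc n m = coeff-⊕ (qbinom n (suc m)) (sumQbinom n m)

gauss-pascal : ∀ n k K → gauss (suc n) (suc k) K ≡ gauss n k K + shift (suc k) (gauss n (suc k)) K
gauss-pascal n k K = trans (coeff-⊕ (qbinom n k) _ K)
    (cong (gauss n k K +_) (coeff-shiftBy (suc k) (qbinom n (suc k)) K))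

gauss-0 : ∀ n K → gauss n 0 K ≡ δ 0 K
gauss-0 zero = coeff-one
gauss-0 (suc n) = coeff-one

gauss-above : ∀ n k → n < k → ∀ K → gauss n k K ≡ 0
gauss-above zero (suc k) _ K = refl
gauss-above (suc n) (suc k) (s≤s n<k) K = begin
  gauss (suc n) (suc k) K ≡⟨ gauss-pascal n k K ⟩
  gauss n k K + shift (suc k) (gauss n (suc k)) K
    ≡⟨ cong₂ _+_ (gauss-above n k n<k K) (shift-cong (suc k) (gauss-above n (suc k) (m<n⇒m<1+n n<k)) K) ⟩
  0 + shift (suc k) (λ _ → 0) K ≡⟨ shift-zero (suc k) K ⟩
  0 ∎

gauss-diag : ∀ n K → gauss n n K ≡ δ 0 K
gauss-diag zero = coeff-one
gauss-diag (suc n) K = begin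
  gauss (suc n) (suc n) K ≡⟨ gauss-pascal n n K ⟩
  gauss n n K + shift (suc n) (gauss n (suc n)) K
    ≡⟨ cong₂ _+_ (gauss-diag n K) (shift-cong (suc n) (gauss-above n (suc n) ≤-refl) K) ⟩
  δ 0 K + shift (suc n) (λ _ → 0) K ≡⟨ cong (δ 0 K +_) (shift-zero (suc n) K) ⟩
  δ 0 K + 0 ≡⟨ +-identityʳ _ ⟩
  δ 0 K ∎

gauss-pascal′ : ∀ k j K → gauss (suc k + j) (suc k) K ≡ gauss (k + j) (suc k) K + shift j (gauss (k + j) k) K
gauss-pascal′ zero zero K = refl
gauss-pascal′ zero (suc j) K = begin
  gauss (suc (suc j)) 1 K ≡⟨ gauss-pascal (suc j) 0 K ⟩
  gauss (suc j) 0 K + shift 1 (gauss (suc j) 1) K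
    ≡⟨ cong₂ _+_ (trans (gauss-0 (suc j) K) (sym (gauss-0 j K)))
         (trans (shift-cong 1 (gauss-pascal′ zero j) K)
           (trans (shift-+ 1 (gauss j 1) _ K) (cong (shift 1 (gauss j 1) K +_) (shift-shift 1 j (gauss j 0) K)))) ⟩
  gauss j 0 K + (shift 1 (gauss j 1) K + shift (suc j) (gauss j 0) K) ≡⟨ +-assoc (gauss j 0 K) _ _ ⟨
  gauss j 0 K + shift 1 (gauss j 1) K + shift (suc j) (gauss j 0) K
    ≡⟨ cong (_+ shift (suc j) (gauss j 0) K) (gauss-pascal j 0 K) ⟨
  gauss (suc j) 1 K + shift (suc j) (gauss j 0) K
    ≡⟨ cong (gauss (suc j) 1 K +_) (shift-cong (suc j) (λ K′ → trans (gauss-0 j K′) (sym (gauss-0 (suc j) K′))) K) ⟩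
  gauss (suc j) 1 K + shift (suc j) (gauss (suc j) 0) K ∎
gauss-pascal′ (suc k) zero K rewrite +-identityʳ k = begin
  gauss (suc (suc k)) (suc (suc k)) K ≡⟨ gauss-diag (suc (suc k)) K ⟩
  δ 0 K ≡⟨ gauss-diag (suc k) K ⟨
  gauss (suc k) (suc k) K ≡⟨ cong (_+ gauss (suc k) (suc k) K) (gauss-above (suc k) (suc (suc k)) ≤-refl K) ⟨
  gauss (suc k) (suc (suc k)) K + gauss (suc k) (suc k) K ∎
gauss-pascal′ (suc k) (suc j) K rewrite +-suc k j = begin
  gauss (3 + n) (2 + k) K ≡⟨ gauss-pascal (2 + n) (1 + k) K ⟩
  gauss (2 + n) (1 + k) K + shift (2 + k) (gauss (2 + n) (2 + k)) K
    ≡⟨ cong₂ _+_ (trans (cong (λ m → gauss (suc m) (suc k) K) (sym (+-suc k j))) (gauss-pascal′ k (suc j) K))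
                 (trans (shift-cong (2 + k) (gauss-pascal′ (suc k) j) K)
                     (shift-+ (2 + k) (gauss (1 + n) (2 + k)) _ K)) ⟩
  (gauss (k + suc j) (1 + k) K + shift (suc j) (gauss (k + suc j) k) K)
    + (shift (2 + k) (gauss (1 + n) (2 + k)) K + shift (2 + k) (shift j (gauss (1 + n) (1 + k))) K)
    ≡⟨ cong (λ m → (gauss m (1 + k) K + shift (suc j) (gauss m k) K) + higher) (+-suc k j) ⟩
  (gauss (1 + n) (1 + k) K + shift (suc j) (gauss (1 + n) k) K)
    + (shift (2 + k) (gauss (1 + n) (2 + k)) K + shift (2 + k) (shift j (gauss (1 + n) (1 + k))) K)
    ≡⟨ +-interchange (gauss (1 + n) (1 + k) K) _ _ _ ⟩
  (gauss (1 + n) (1 + k) K + shift (2 + k) (gauss (1 + n) (2 + k)) K)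
    + (shift (suc j) (gauss (1 + n) k) K + shift (2 + k) (shift j (gauss (1 + n) (1 + k))) K)
    ≡⟨ cong₂ _+_ (sym (gauss-pascal (1 + n) (1 + k) K))
                 (cong (shift (suc j) (gauss (1 + n) k) K +_)
                     (shift-regroup (2 + k) j (suc j) (suc k) 2+k+j≡1+j+1+k _ K)) ⟩
  gauss (2 + n) (2 + k) K
    + (shift (suc j) (gauss (1 + n) k) K + shift (suc j) (shift (suc k) (gauss (1 + n) (1 + k))) K)
    ≡⟨ cong (gauss (2 + n) (2 + k) K +_)
         (trans (sym (shift-+ (suc j) (gauss (1 + n) k) _ K))
             (shift-cong (suc j) (λ K′ → sym (gauss-pascal (1 + n) k K′)) K)) ⟩
  gauss (2 + n) (2 + k) K + shift (suc j) (gauss (2 + n) (1 + k)) K ∎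
  where
  n : ℕ
  n = k + j
  higher : ℕ
  higher = shift (2 + k) (gauss (1 + n) (2 + k)) K + shift (2 + k) (shift j (gauss (1 + n) (1 + k))) K
  2+k+j≡1+j+1+k : 2 + k + j ≡ suc j + suc k
  2+k+j≡1+j+1+k = cong suc (trans (cong suc (+-comm k j)) (sym (+-suc j k)))

descending : ℕ → Word → Bool
descending d [] = true
descending d (x ∷ xs) = (1 ≤ᵇ x) ∧ (x ≤ᵇ d) ∧ descending x xs

lastOr : ℕ → Word → ℕ
lastOr d [] = d
lastOr d (x ∷ xs) = lastOr x xs

lastOr-∷ʳ : ∀ d v z → lastOr d (v ++ [ z ]) ≡ z
lastOr-∷ʳ d [] z = refl
lastOr-∷ʳ d (x ∷ v) z = lastOr-∷ʳ x v z

descending-∷ʳ : ∀ d v z → descending d (v ++ [ z ]) ≡ descending d v ∧ (1 ≤ᵇ z) ∧ (z ≤ᵇ lastOr d v)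
descending-∷ʳ d [] z = cong ((1 ≤ᵇ z) ∧_) (∧-identityʳ (z ≤ᵇ d))
descending-∷ʳ d (x ∷ v) z = begin
  (1 ≤ᵇ x) ∧ (x ≤ᵇ d) ∧ descending x (v ++ [ z ]) ≡⟨ cong (λ b → (1 ≤ᵇ x) ∧ (x ≤ᵇ d) ∧ b) (descending-∷ʳ x v z) ⟩
  (1 ≤ᵇ x) ∧ (x ≤ᵇ d) ∧ descending x v ∧ rest      ≡⟨ cong ((1 ≤ᵇ x) ∧_) (∧-assoc (x ≤ᵇ d) _ rest) ⟨
  (1 ≤ᵇ x) ∧ ((x ≤ᵇ d) ∧ descending x v) ∧ rest    ≡⟨ ∧-assoc (1 ≤ᵇ x) _ rest ⟨
  ((1 ≤ᵇ x) ∧ (x ≤ᵇ d) ∧ descending x v) ∧ rest    ∎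
  where
  rest : Bool
  rest = (1 ≤ᵇ z) ∧ (z ≤ᵇ lastOr x v)

descending-∷⁻ : ∀ x y ys → descending x (y ∷ ys) ≡ true → 1 ≤ y × y ≤ x × descending y ys ≡ true
descending-∷⁻ x y ys desc with 1 ≤ᵇ y in 1≤y | y ≤ᵇ x in y≤x | descending y ys
... | true | true | true = ≤ᵇ-true⁻¹ 1≤y , ≤ᵇ-true⁻¹ y≤x , refl

descending-∷⁺ : ∀ {x y} ys → 1 ≤ y → y ≤ x → descending y ys ≡ true → descending x (y ∷ ys) ≡ true
descending-∷⁺ {y = y} ys 1≤y y≤x desc =
  trans (cong₂ (λ a b → a ∧ b ∧ descending y ys) (≤ᵇ-true 1≤y) (≤ᵇ-true y≤x)) desc

lastOr-≤ : ∀ d v → descending d v ≡ true → lastOr d v ≤ d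
lastOr-≤ d [] _ = ≤-refl
lastOr-≤ d (x ∷ xs) desc with descending-∷⁻ d x xs desc
... | _ , x≤d , desc-xs = ≤-trans (lastOr-≤ x xs desc-xs) x≤d

descendingSum : ℕ → ℕ → (Word → ℕ) → ℕ → Series
descendingSum N k S r K = sumWords N r (λ v → when (descending k v) (δ (S v) K))

-- Weakly decreasing words are built by appending letters, since appending to v changes lb and rs of
-- 1 ⋯ k v by amounts depending only on the new letter and the last letter and length of v.
module DescendingSum (N k : ℕ) (c : ℕ → ℕ → ℕ → ℕ) (S : Word → ℕ)
  (S-[] : S [] ≡ 0)
  (S-∷ʳ : ∀ v z → descending k (v ++ [ z ]) ≡ true → S (v ++ [ z ]) ≡ S v + c (lastOr k v) (length v) z)
  where

  ending : ℕ → ℕ → Series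
  ending r y K = sumWords N r (λ v → when (descending k (v ++ [ y ])) (δ (S (v ++ [ y ])) K))

  descendingSum-suc : ∀ r K → descendingSum N k S (suc r) K ≡ sumRange N (λ i → ending r (suc i) K)
  descendingSum-suc r K = sumWords-∷ʳ r _

  ending-zero : ∀ y K → 1 ≤ y → y ≤ k → ending 0 y K ≡ δ (c k 0 y) K
  ending-zero y K 1≤y y≤k = begin
    ending 0 y K ≡⟨ sumWords-[] {N} (λ v → when (descending k (v ++ [ y ])) (δ (S (v ++ [ y ])) K)) ⟩
    when ((1 ≤ᵇ y) ∧ (y ≤ᵇ k) ∧ true) (δ (S [ y ]) K)
      ≡⟨ cong₂ (λ b s → when b (δ s K)) desc (S-∷ʳ [] y desc) ⟩
    δ (S [] + c k 0 y) K ≡⟨ cong (λ s → δ (s + c k 0 y) K) S-[] ⟩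
    δ (c k 0 y) K ∎
    where
    desc : descending k [ y ] ≡ true
    desc = descending-∷⁺ [] 1≤y y≤k refl

  ending-above : ∀ r y → k < y → ∀ K → ending r y K ≡ 0
  ending-above r y k<y K = trans (sumWords-cong r (λ v _ → cong (λ b → when b _) (not-desc v))) (sumWords-zero r)
    where
    not-desc : ∀ v → descending k (v ++ [ y ]) ≡ false
    not-desc v with descending k v in desc
    ... | false = trans (descending-∷ʳ k v y) (cong (_∧ (1 ≤ᵇ y) ∧ (y ≤ᵇ lastOr k v)) desc)
    ... | true = begin
      descending k (v ++ [ y ]) ≡⟨ descending-∷ʳ k v y ⟩
      descending k v ∧ (1 ≤ᵇ y) ∧ (y ≤ᵇ lastOr k v)
        ≡⟨ cong₂ (λ a b → a ∧ (1 ≤ᵇ y) ∧ b) desc (≤ᵇ-false (≤-<-trans (lastOr-≤ k v desc) k<y)) ⟩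
      (1 ≤ᵇ y) ∧ false ≡⟨ ∧-zeroʳ (1 ≤ᵇ y) ⟩
      false ∎

  ending-suc : ∀ r y K → ending (suc r) y K
      ≡ sumRange N (λ i → when ((1 ≤ᵇ y) ∧ (y ≤ᵇ suc i)) (shift (c (suc i) (suc r) y) (ending r (suc i)) K))
  ending-suc r y K = trans (sumWords-∷ʳ r _) (sumRange-cong N (λ i _ → begin
    sumWords N r (λ w → when (descending k ((w ++ [ suc i ]) ++ [ y ])) (δ (S ((w ++ [ suc i ]) ++ [ y ])) K))
      ≡⟨ sumWords-cong r (λ w |w| → appending-twice w (suc i) |w|) ⟩
    sumWords N r (λ w → when ((1 ≤ᵇ y) ∧ (y ≤ᵇ suc i))
        (shift (c (suc i) (suc r) y) (λ K′ → when (descending k (w ++ [ suc i ])) (δ (S (w ++ [ suc i ])) K′)) K))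
      ≡⟨ sumWords-when r _ _ ⟩
    when ((1 ≤ᵇ y) ∧ (y ≤ᵇ suc i))
      (sumWords N r (λ w → shift (c (suc i) (suc r) y)
                                 (λ K′ → when (descending k (w ++ [ suc i ])) (δ (S (w ++ [ suc i ])) K′)) K))
      ≡⟨ cong (when _) (sumWords-shift r (c (suc i) (suc r) y) _ K) ⟩
    when ((1 ≤ᵇ y) ∧ (y ≤ᵇ suc i)) (shift (c (suc i) (suc r) y) (ending r (suc i)) K) ∎))
    where
    descending-twice : ∀ w x → descending k ((w ++ [ x ]) ++ [ y ]) ≡ descending k (w ++ [ x ]) ∧ (1 ≤ᵇ y) ∧ (y ≤ᵇ x)
    descending-twice w x = trans (descending-∷ʳ k (w ++ [ x ]) y)
      (cong (λ l → descending k (w ++ [ x ]) ∧ (1 ≤ᵇ y) ∧ (y ≤ᵇ l)) (lastOr-∷ʳ k w x))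

    appending-twice : ∀ w x → length w ≡ r →
      when (descending k ((w ++ [ x ]) ++ [ y ])) (δ (S ((w ++ [ x ]) ++ [ y ])) K)
      ≡ when ((1 ≤ᵇ y) ∧ (y ≤ᵇ x)) (shift (c x (suc r) y)
          (λ K′ → when (descending k (w ++ [ x ])) (δ (S (w ++ [ x ])) K′)) K)
    appending-twice w x |w| with descending k (w ++ [ x ]) in desc | (1 ≤ᵇ y) ∧ (y ≤ᵇ x) in y≤x
    ... | false | b = begin
      when (descending k ((w ++ [ x ]) ++ [ y ])) _
        ≡⟨ cong (λ d → when d _) (trans (descending-twice w x) (cong (_∧ _) desc)) ⟩
      0 ≡⟨ when-zero b ⟨
      when b 0 ≡⟨ cong (when b) (shift-zero (c x (suc r) y) K) ⟨
      when b (shift (c x (suc r) y) (λ _ → 0) K) ∎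
    ... | true | false = cong (λ d → when d _) (trans (descending-twice w x) (cong₂ _∧_ desc y≤x))
    ... | true | true = begin
      when (descending k ((w ++ [ x ]) ++ [ y ])) (δ (S ((w ++ [ x ]) ++ [ y ])) K) ≡⟨ cong (λ d → when d _) desc′ ⟩
      δ (S ((w ++ [ x ]) ++ [ y ])) K ≡⟨ cong (λ s → δ s K) (S-∷ʳ (w ++ [ x ]) y desc′) ⟩
      δ (S (w ++ [ x ]) + c (lastOr k (w ++ [ x ])) (length (w ++ [ x ])) y) K
        ≡⟨ cong₂ (λ l n → δ (S (w ++ [ x ]) + c l n y) K) (lastOr-∷ʳ k w x)
          (trans (length-++ w) (trans (+-comm (length w) 1) (cong suc |w|))) ⟩
      δ (S (w ++ [ x ]) + c x (suc r) y) K ≡⟨ cong (λ s → δ s K) (+-comm (S (w ++ [ x ])) _) ⟩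
      δ (c x (suc r) y + S (w ++ [ x ])) K ≡⟨ shift-δ (c x (suc r) y) (S (w ++ [ x ])) K ⟨
      shift (c x (suc r) y) (δ (S (w ++ [ x ]))) K ∎
      where
      desc′ : descending k ((w ++ [ x ]) ++ [ y ]) ≡ true
      desc′ = trans (descending-twice w x) (cong₂ _∧_ desc y≤x)

  endingAbove : ℕ → ℕ → Series
  endingAbove r y K = sumRange k (λ i → when (y <ᵇ suc i) (ending r (suc i) K))

  endingAbove-top : ∀ r K → endingAbove r k K ≡ 0
  endingAbove-top r K = trans (sumRange-cong k (λ i i<k → cong (λ b → when b (ending r (suc i) K)) (<ᵇ-false i<k)))
      (sumRange-zero k)

  endingAbove-suc : ∀ r y K → y < k → endingAbove r y K ≡ ending r (suc y) K + endingAbove r (suc y) K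
  endingAbove-suc r y K y<k = begin
    endingAbove r y K ≡⟨ sumRange-cong k (λ i _ → when-<ᵇ-suc y i (ending r (suc i) K)) ⟩
    sumRange k (λ i → when (i ≡ᵇ y) (ending r (suc i) K) + when (y <ᵇ i) (ending r (suc i) K)) ≡⟨ sumRange-+ k _ _ ⟩
    sumRange k (λ i → when (i ≡ᵇ y) (ending r (suc i) K)) + endingAbove r (suc y) K
      ≡⟨ cong (_+ endingAbove r (suc y) K) (sumRange-pick k y (λ i → ending r (suc i) K) y<k) ⟩
    ending r (suc y) K + endingAbove r (suc y) K ∎

  EndingClosed : ℕ → Set
  EndingClosed r = ∀ a y → 1 ≤ y → y + a ≡ k → ∀ K → ending r y K ≡ shift a (gauss (a + r) r) K

  endingAbove-closed : ∀ r → EndingClosed r → ∀ a y → y + a ≡ k → ∀ K → endingAbove r y K ≡ gauss (a + r) (suc r) K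
  endingAbove-closed r closed zero y y+0≡k K rewrite +-identityʳ y | y+0≡k =
    trans (endingAbove-top r K) (sym (gauss-above r (suc r) ≤-refl K))
  endingAbove-closed r closed (suc a) y y+1+a≡k K = begin
    endingAbove r y K ≡⟨ endingAbove-suc r y K (subst (y <_) y+1+a≡k (m<m+n y z<s)) ⟩
    ending r (suc y) K + endingAbove r (suc y) K
      ≡⟨ cong₂ _+_ (closed a (suc y) (s≤s z≤n) 1+y+a≡k K) (endingAbove-closed r closed a (suc y) 1+y+a≡k K) ⟩
    shift a (gauss (a + r) r) K + gauss (a + r) (suc r) K ≡⟨ +-comm _ (gauss (a + r) (suc r) K) ⟩
    gauss (a + r) (suc r) K + shift a (gauss (a + r) r) K
      ≡⟨ cong (λ n → gauss n (suc r) K + shift a (gauss n r) K) (+-comm a r) ⟩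
    gauss (r + a) (suc r) K + shift a (gauss (r + a) r) K ≡⟨ gauss-pascal′ r a K ⟨
    gauss (suc r + a) (suc r) K ≡⟨ cong (λ n → gauss (suc n) (suc r) K) (+-comm r a) ⟩
    gauss (suc a + r) (suc r) K ∎
    where
    1+y+a≡k : suc y + a ≡ k
    1+y+a≡k = trans (sym (+-suc y a)) y+1+a≡k

  module _ (k≤N : k ≤ N) where

    sumRange-ending : ∀ r (b : ℕ → Bool) K → sumRange N (λ i → when (b i) (ending r (suc i) K))
        ≡ sumRange k (λ i → when (b i) (ending r (suc i) K))
    sumRange-ending r b K = sumRange-truncate N k _ k≤N
        (λ i k≤i → trans (cong (when (b i)) (ending-above r (suc i) (s≤s k≤i) K)) (when-zero (b i)))

    descendingSum-closed : ∀ r → EndingClosed r → ∀ K → descendingSum N k S (suc r) K ≡ gauss (k + r) (suc r) K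
    descendingSum-closed r closed K = begin
      descendingSum N k S (suc r) K ≡⟨ descendingSum-suc r K ⟩
      sumRange N (λ i → ending r (suc i) K) ≡⟨ sumRange-ending r (λ _ → true) K ⟩
      endingAbove r 0 K ≡⟨ endingAbove-closed r closed k 0 refl K ⟩
      gauss (k + r) (suc r) K ∎

-- Appending z, at most the last letter, to 1 ⋯ k v raises lb by k ∸ z; it raises rs by k ∸ z
-- (the letters of 1 ⋯ k above z) plus |v| (the letters of v, all above z), unless z repeats the last letter.
lbCost : ℕ → ℕ → ℕ → ℕ → ℕ
lbCost k _ _ z = k ∸ z

rsCost : ℕ → ℕ → ℕ → ℕ → ℕ
rsCost k h l z = if z ≡ᵇ h then 0 else (k ∸ z) + l

filter-cong : ∀ {P Q : Pred A ℓ} (P? : Decidable P) (Q? : Decidable Q) → (∀ x → does (P? x) ≡ does (Q? x)) →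
              ∀ xs → filter P? xs ≡ filter Q? xs
filter-cong P? Q? same [] = refl
filter-cong P? Q? same (x ∷ xs) with does (P? x) | does (Q? x) | same x
... | true | true | refl = cong (x ∷_) (filter-cong P? Q? same xs)
... | false | false | refl = filter-cong P? Q? same xs

filter-map : ∀ {P : Pred B ℓ} (P? : Decidable P) (f : A → B) xs → filter P? (map f xs) ≡ map f (filter (P? ∘ f) xs)
filter-map P? f [] = refl
filter-map P? f (x ∷ xs) with does (P? (f x))
... | true = cong (f x ∷_) (filter-map P? f xs)
... | false = filter-map P? f xs

distinct-∷ : ∀ x xs → distinct (x ∷ xs) ≡ x ∷ filterᵇ (λ y → not (x ≡ᵇ y)) (distinct xs)
distinct-∷ x xs = cong (x ∷_) (filter-cong _ _ (λ _ → refl) (distinct xs))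

occurs : ℕ → Word → Bool
occurs z = any (_≡ᵇ z)

filterᵇ-comm : ∀ (p q : A → Bool) xs → filterᵇ p (filterᵇ q xs) ≡ filterᵇ q (filterᵇ p xs)
filterᵇ-comm p q [] = refl
filterᵇ-comm p q (x ∷ xs) with p x in px | q x in qx
... | true | true rewrite px | qx = cong (x ∷_) (filterᵇ-comm p q xs)
... | true | false rewrite qx = filterᵇ-comm p q xs
... | false | true rewrite px = filterᵇ-comm p q xs
... | false | false = filterᵇ-comm p q xs

filterᵇ-absorb : ∀ (p q : A → Bool) xs → (∀ y → p y ≡ true → q y ≡ true) →
                 filterᵇ p (filterᵇ q xs) ≡ filterᵇ p xs
filterᵇ-absorb p q [] _ = refl
filterᵇ-absorb p q (x ∷ xs) p⇒q with p x in px | q x in qx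
... | true | true rewrite px = cong (x ∷_) (filterᵇ-absorb p q xs p⇒q)
... | true | false with () ← trans (sym qx) (p⇒q x px)
... | false | true rewrite px = filterᵇ-absorb p q xs p⇒q
... | false | false = filterᵇ-absorb p q xs p⇒q

occurs-filterᵇ : ∀ (p : ℕ → Bool) z xs → occurs z (filterᵇ p xs) ≡ p z ∧ occurs z xs
occurs-filterᵇ p z [] = sym (∧-zeroʳ (p z))
occurs-filterᵇ p z (y ∷ ys) with p y in py
... | true with y ≡ᵇ z in y≡z
...   | false = occurs-filterᵇ p z ys
...   | true with refl ← ≡ᵇ-true⁻¹ {y} {z} y≡z rewrite py = refl
occurs-filterᵇ p z (y ∷ ys) | false with y ≡ᵇ z in y≡z
...   | false = occurs-filterᵇ p z ys
...   | true with refl ← ≡ᵇ-true⁻¹ {y} {z} y≡z =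
  trans (occurs-filterᵇ p y ys) (trans (cong (_∧ occurs y ys) py) (sym (cong (_∧ true) py)))

∨-not-∧ : ∀ a b → a ∨ (not a ∧ b) ≡ a ∨ b
∨-not-∧ true b = refl
∨-not-∧ false b = refl

occurs-distinct : ∀ z xs → occurs z (distinct xs) ≡ occurs z xs
occurs-distinct z [] = refl
occurs-distinct z (x ∷ xs) = begin
  occurs z (distinct (x ∷ xs)) ≡⟨ cong (occurs z) (distinct-∷ x xs) ⟩
  (x ≡ᵇ z) ∨ occurs z (filterᵇ (λ y → not (x ≡ᵇ y)) (distinct xs))
      ≡⟨ cong ((x ≡ᵇ z) ∨_) (occurs-filterᵇ _ z (distinct xs)) ⟩
  (x ≡ᵇ z) ∨ (not (x ≡ᵇ z) ∧ occurs z (distinct xs))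
      ≡⟨ cong (λ b → (x ≡ᵇ z) ∨ (not (x ≡ᵇ z) ∧ b)) (occurs-distinct z xs) ⟩
  (x ≡ᵇ z) ∨ (not (x ≡ᵇ z) ∧ occurs z xs) ≡⟨ ∨-not-∧ (x ≡ᵇ z) _ ⟩
  (x ≡ᵇ z) ∨ occurs z xs ∎

occurs-++ : ∀ z xs ys → occurs z (xs ++ ys) ≡ occurs z xs ∨ occurs z ys
occurs-++ z [] ys = refl
occurs-++ z (x ∷ xs) ys = trans (cong ((x ≡ᵇ z) ∨_) (occurs-++ z xs ys)) (sym (∨-assoc (x ≡ᵇ z) _ _))

newLetter : ℕ → Word → Word
newLetter z xs = if occurs z xs then [] else [ z ]

distinct-∷ʳ : ∀ xs z → distinct (xs ++ [ z ]) ≡ distinct xs ++ newLetter z xs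
distinct-∷ʳ [] z = refl
distinct-∷ʳ (x ∷ xs) z = begin
  distinct (x ∷ xs ++ [ z ]) ≡⟨ distinct-∷ x (xs ++ [ z ]) ⟩
  x ∷ filterᵇ (λ y → not (x ≡ᵇ y)) (distinct (xs ++ [ z ])) ≡⟨ cong (λ ds → x ∷ filterᵇ _ ds) (distinct-∷ʳ xs z) ⟩
  x ∷ filterᵇ (λ y → not (x ≡ᵇ y)) (distinct xs ++ newLetter z xs)
    ≡⟨ cong (x ∷_) (filter-++ _ (distinct xs) (newLetter z xs)) ⟩
  x ∷ filterᵇ (λ y → not (x ≡ᵇ y)) (distinct xs) ++ filterᵇ (λ y → not (x ≡ᵇ y)) (newLetter z xs)
    ≡⟨ cong₂ (λ ds n → x ∷ ds ++ n) refl (filter-newLetter (occurs z xs)) ⟩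
  x ∷ filterᵇ (λ y → not (x ≡ᵇ y)) (distinct xs) ++ newLetter z (x ∷ xs)
    ≡⟨ cong (_++ newLetter z (x ∷ xs)) (distinct-∷ x xs) ⟨
  distinct (x ∷ xs) ++ newLetter z (x ∷ xs) ∎
  where
  filter-newLetter : ∀ b → filterᵇ (λ y → not (x ≡ᵇ y)) (if b then [] else [ z ])
      ≡ (if (x ≡ᵇ z) ∨ b then [] else [ z ])
  filter-newLetter true rewrite ∨-zeroʳ (x ≡ᵇ z) = refl
  filter-newLetter false rewrite ∨-identityʳ (x ≡ᵇ z) with x ≡ᵇ z
  ... | true = refl
  ... | false = refl

filterᵇ-accept : ∀ {p : A → Bool} {x} xs → p x ≡ true → filterᵇ p (x ∷ xs) ≡ x ∷ filterᵇ p xs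
filterᵇ-accept {p = p} xs px = filter-accept (T? ∘ p) (≡true⇒T px)

filterᵇ-reject : ∀ {p : A → Bool} {x} xs → p x ≡ false → filterᵇ p (x ∷ xs) ≡ filterᵇ p xs
filterᵇ-reject {p = p} xs px = filter-reject (T? ∘ p) (λ t → subst T px t)

distinct-filterᵇ : ∀ p xs → distinct (filterᵇ p xs) ≡ filterᵇ p (distinct xs)
distinct-filterᵇ p [] = refl
distinct-filterᵇ p (x ∷ xs) = by-cases (p x) refl
  where
  ≢x : ℕ → Bool
  ≢x y = not (x ≡ᵇ y)
  by-cases : ∀ b → p x ≡ b → distinct (filterᵇ p (x ∷ xs)) ≡ filterᵇ p (distinct (x ∷ xs))
  by-cases true px = begin
    distinct (filterᵇ p (x ∷ xs)) ≡⟨ cong distinct (filterᵇ-accept xs px) ⟩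
    distinct (x ∷ filterᵇ p xs) ≡⟨ distinct-∷ x (filterᵇ p xs) ⟩
    x ∷ filterᵇ ≢x (distinct (filterᵇ p xs)) ≡⟨ cong (λ ds → x ∷ filterᵇ ≢x ds) (distinct-filterᵇ p xs) ⟩
    x ∷ filterᵇ ≢x (filterᵇ p (distinct xs)) ≡⟨ cong (x ∷_) (filterᵇ-comm ≢x p (distinct xs)) ⟩
    x ∷ filterᵇ p (filterᵇ ≢x (distinct xs)) ≡⟨ filterᵇ-accept {p = p} (filterᵇ ≢x (distinct xs)) px ⟨
    filterᵇ p (x ∷ filterᵇ ≢x (distinct xs)) ≡⟨ cong (filterᵇ p) (distinct-∷ x xs) ⟨
    filterᵇ p (distinct (x ∷ xs)) ∎
  by-cases false px = begin
    distinct (filterᵇ p (x ∷ xs)) ≡⟨ cong distinct (filterᵇ-reject xs px) ⟩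
    distinct (filterᵇ p xs) ≡⟨ distinct-filterᵇ p xs ⟩
    filterᵇ p (distinct xs) ≡⟨ filterᵇ-absorb p ≢x (distinct xs) p⇒≢x ⟨
    filterᵇ p (filterᵇ ≢x (distinct xs)) ≡⟨ filterᵇ-reject {p = p} (filterᵇ ≢x (distinct xs)) px ⟨
    filterᵇ p (x ∷ filterᵇ ≢x (distinct xs)) ≡⟨ cong (filterᵇ p) (distinct-∷ x xs) ⟨
    filterᵇ p (distinct (x ∷ xs)) ∎
    where
    p⇒≢x : ∀ y → p y ≡ true → ≢x y ≡ true
    p⇒≢x y py with x ≡ᵇ y in x≡y
    ... | false = refl
    ... | true with refl ← ≡ᵇ-true⁻¹ {x} {y} x≡y with () ← trans (sym px) py

distinctCount : (ℕ → Bool) → Word → ℕ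
distinctCount p xs = length (distinct (filterᵇ p xs))

distinctCount-∷ʳ : ∀ p v z → distinctCount p (v ++ [ z ]) ≡ distinctCount p v + when (p z ∧ not (occurs z v)) 1
distinctCount-∷ʳ p v z = begin
  length (distinct (filterᵇ p (v ++ [ z ]))) ≡⟨ cong length (distinct-filterᵇ p (v ++ [ z ])) ⟩
  length (filterᵇ p (distinct (v ++ [ z ]))) ≡⟨ cong (length ∘ filterᵇ p) (distinct-∷ʳ v z) ⟩
  length (filterᵇ p (distinct v ++ newLetter z v)) ≡⟨ cong length (filter-++ _ (distinct v) (newLetter z v)) ⟩
  length (filterᵇ p (distinct v) ++ filterᵇ p (newLetter z v)) ≡⟨ length-++ (filterᵇ p (distinct v)) ⟩
  length (filterᵇ p (distinct v)) + length (filterᵇ p (newLetter z v))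
    ≡⟨ cong₂ _+_ (cong length (distinct-filterᵇ p v)) (new (occurs z v)) ⟨
  distinctCount p v + when (p z ∧ not (occurs z v)) 1 ∎
  where
  new : ∀ b → when (p z ∧ not b) 1 ≡ length (filterᵇ p (if b then [] else [ z ]))
  new true rewrite ∧-zeroʳ (p z) = refl
  new false rewrite ∧-identityʳ (p z) with p z
  ... | true = refl
  ... | false = refl

rsGain : Word → ℕ → ℕ
rsGain [] z = 0
rsGain (y ∷ ys) z = when ((z <ᵇ y) ∧ not (occurs z ys)) 1 + rsGain ys z

rs-∷ʳ : ∀ v z → rs (v ++ [ z ]) ≡ rs v + rsGain v z
rs-∷ʳ [] z = refl
rs-∷ʳ (y ∷ v) z = begin
  distinctCount (_<ᵇ y) (v ++ [ z ]) + rs (v ++ [ z ])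
    ≡⟨ cong₂ _+_ (distinctCount-∷ʳ (_<ᵇ y) v z) (rs-∷ʳ v z) ⟩
  (distinctCount (_<ᵇ y) v + when ((z <ᵇ y) ∧ not (occurs z v)) 1) + (rs v + rsGain v z)
    ≡⟨ +-interchange (distinctCount (_<ᵇ y) v) _ _ _ ⟩
  (distinctCount (_<ᵇ y) v + rs v) + (when ((z <ᵇ y) ∧ not (occurs z v)) 1 + rsGain v z) ∎

oneTo : ℕ → Word
oneTo zero = []
oneTo (suc M) = oneTo M ++ [ suc M ]

lastOr-++ : ∀ d a b → lastOr d (a ++ b) ≡ lastOr (lastOr d a) b
lastOr-++ d [] b = refl
lastOr-++ d (x ∷ a) b = lastOr-++ x a b

lastOr-oneTo : ∀ k → lastOr k (oneTo k) ≡ k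
lastOr-oneTo zero = refl
lastOr-oneTo (suc k) = lastOr-∷ʳ (suc k) (oneTo k) (suc k)

occurs-oneTo : ∀ x M → 1 ≤ x → x ≤ M → occurs x (oneTo M) ≡ true
occurs-oneTo zero zero () _
occurs-oneTo (suc x) zero _ ()
occurs-oneTo x (suc M) 1≤x x≤1+M rewrite occurs-++ x (oneTo M) [ suc M ] with x ≟ suc M
... | yes refl rewrite ≡ᵇ-refl (suc M) = ∨-zeroʳ _
... | no x≢1+M rewrite occurs-oneTo x M 1≤x (≤-pred (≤∧≢⇒< x≤1+M x≢1+M)) = refl

occurs-oneTo-> : ∀ x M → M < x → occurs x (oneTo M) ≡ false
occurs-oneTo-> x zero _ = refl
occurs-oneTo-> x (suc M) M<x rewrite occurs-++ x (oneTo M) [ suc M ] | occurs-oneTo-> x M (<-trans (n<1+n M) M<x)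
  | ≡ᵇ-false (<⇒≢ M<x) = refl

length-filterᵇ-singleton : ∀ (p : ℕ → Bool) z → length (filterᵇ p [ z ]) ≡ when (p z) 1
length-filterᵇ-singleton p z with p z
... | true = refl
... | false = refl

∸-suc : ∀ x M → (M ∸ x) + when (x <ᵇ suc M) 1 ≡ suc M ∸ x
∸-suc x M with x ≤? M
... | yes x≤M rewrite <ᵇ-true (s≤s x≤M) = trans (+-comm (M ∸ x) 1) (sym (+-∸-assoc 1 x≤M))
... | no x≰M rewrite <ᵇ-false {x} {suc M} (≰⇒> x≰M)
    | m≤n⇒m∸n≡0 (≰⇒> x≰M) = trans (+-identityʳ _) (m≤n⇒m∸n≡0 (<⇒≤ (≰⇒> x≰M)))

countAbove-oneTo : ∀ x M → length (filterᵇ (x <ᵇ_) (oneTo M)) ≡ M ∸ x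
countAbove-oneTo x zero = sym (0∸n≡0 x)
countAbove-oneTo x (suc M) = begin
  length (filterᵇ (x <ᵇ_) (oneTo M ++ [ suc M ])) ≡⟨ cong length (filter-++ _ (oneTo M) [ suc M ]) ⟩
  length (filterᵇ (x <ᵇ_) (oneTo M) ++ filterᵇ (x <ᵇ_) [ suc M ]) ≡⟨ length-++ (filterᵇ (x <ᵇ_) (oneTo M)) ⟩
  length (filterᵇ (x <ᵇ_) (oneTo M)) + length (filterᵇ (x <ᵇ_) [ suc M ])
    ≡⟨ cong₂ _+_ (countAbove-oneTo x M) (length-filterᵇ-singleton (x <ᵇ_) (suc M)) ⟩
  (M ∸ x) + when (x <ᵇ suc M) 1 ≡⟨ ∸-suc x M ⟩
  suc M ∸ x ∎

rsGain-++ : ∀ a b z → occurs z b ≡ false → rsGain (a ++ b) z ≡ rsGain a z + rsGain b z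
rsGain-++ [] b z _ = refl
rsGain-++ (y ∷ a) b z z∉b rewrite occurs-++ z a b | z∉b | ∨-identityʳ (occurs z a) | rsGain-++ a b z z∉b =
  sym (+-assoc _ (rsGain a z) (rsGain b z))

occurs-lastOr : ∀ t ts → occurs (lastOr t ts) (t ∷ ts) ≡ true
occurs-lastOr t [] rewrite ≡ᵇ-refl t = refl
occurs-lastOr t (u ∷ us) rewrite occurs-lastOr u us = ∨-zeroʳ _

rsGain-lastOr : ∀ d a → rsGain a (lastOr d a) ≡ 0
rsGain-lastOr d [] = refl
rsGain-lastOr d (y ∷ []) rewrite <ᵇ-false {y} {y} ≤-refl = refl
rsGain-lastOr d (y ∷ t ∷ ts) = cong₂ _+_ first (rsGain-lastOr y (t ∷ ts))
  where
  first : when ((lastOr t ts <ᵇ y) ∧ not (occurs (lastOr t ts) (t ∷ ts))) 1 ≡ 0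
  first rewrite occurs-lastOr t ts | ∧-zeroʳ (lastOr t ts <ᵇ y) = refl

rsGain-oneTo : ∀ k z → rsGain (oneTo k) z ≡ k ∸ z
rsGain-oneTo zero z = sym (0∸n≡0 z)
rsGain-oneTo (suc k) z with z ≟ suc k
... | yes refl = trans (subst (λ l → rsGain (oneTo (suc k)) l ≡ 0) (lastOr-oneTo (suc k))
    (rsGain-lastOr (suc k) (oneTo (suc k)))) (sym (n∸n≡0 (suc k)))
... | no z≢1+k = begin
  rsGain (oneTo k ++ [ suc k ]) z ≡⟨ rsGain-++ (oneTo k) [ suc k ] z (cong (_∨ false) (≡ᵇ-false (z≢1+k ∘ sym))) ⟩
  rsGain (oneTo k) z + (when ((z <ᵇ suc k) ∧ true) 1 + 0)
    ≡⟨ cong₂ _+_ (rsGain-oneTo k z) (trans (+-identityʳ _) (cong (λ b → when b 1) (∧-identityʳ _))) ⟩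
  (k ∸ z) + when (z <ᵇ suc k) 1 ≡⟨ ∸-suc z k ⟩
  suc k ∸ z ∎

rs-oneTo : ∀ k → rs (oneTo k) ≡ 0
rs-oneTo zero = refl
rs-oneTo (suc k) = begin
  rs (oneTo k ++ [ suc k ]) ≡⟨ rs-∷ʳ (oneTo k) (suc k) ⟩
  rs (oneTo k) + rsGain (oneTo k) (suc k) ≡⟨ cong₂ _+_ (rs-oneTo k) (rsGain-oneTo k (suc k)) ⟩
  0 + (k ∸ suc k) ≡⟨ m≤n⇒m∸n≡0 (n≤1+n k) ⟩
  0 ∎

descending-≥-last : ∀ d v → descending d v ≡ true → All (lastOr d v ≤_) v
descending-≥-last d [] _ = []
descending-≥-last d (x ∷ xs) desc with descending-∷⁻ d x xs desc
... | _ , _ , desc-xs = lastOr-≤ x xs desc-xs ∷ descending-≥-last x xs desc-xs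

occurs-below-all : ∀ z v → All (z <_) v → occurs z v ≡ false
occurs-below-all z [] [] = refl
occurs-below-all z (y ∷ v) (z<y ∷ z<v) rewrite ≡ᵇ-false (>⇒≢ z<y) = occurs-below-all z v z<v

rsGain-below-all : ∀ z v → All (z <_) v → rsGain v z ≡ length v
rsGain-below-all z [] [] = refl
rsGain-below-all z (y ∷ v) (z<y ∷ z<v) rewrite <ᵇ-true z<y
    | occurs-below-all z v z<v = cong suc (rsGain-below-all z v z<v)

rs-oneTo-∷ʳ : ∀ k v z → descending k (v ++ [ z ]) ≡ true →
  rs (oneTo k ++ v ++ [ z ]) ≡ rs (oneTo k ++ v) + rsCost k (lastOr k v) (length v) z
rs-oneTo-∷ʳ k v z desc = begin
  rs (oneTo k ++ v ++ [ z ]) ≡⟨ cong rs (++-assoc (oneTo k) v [ z ]) ⟨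
  rs ((oneTo k ++ v) ++ [ z ]) ≡⟨ rs-∷ʳ (oneTo k ++ v) z ⟩
  rs (oneTo k ++ v) + rsGain (oneTo k ++ v) z ≡⟨ cong (rs (oneTo k ++ v) +_) gain ⟩
  rs (oneTo k ++ v) + rsCost k (lastOr k v) (length v) z ∎
  where
  split : descending k v ≡ true × ((1 ≤ᵇ z) ∧ (z ≤ᵇ lastOr k v)) ≡ true
  split = ∧-true⁻¹ {descending k v} (trans (sym (descending-∷ʳ k v z)) desc)
  z≤last : z ≤ lastOr k v
  z≤last = ≤ᵇ-true⁻¹ (proj₂ (∧-true⁻¹ {1 ≤ᵇ z} (proj₂ split)))
  gain : rsGain (oneTo k ++ v) z ≡ rsCost k (lastOr k v) (length v) z
  gain with z ≡ᵇ lastOr k v in z≡last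
  ... | true = subst (λ l → rsGain (oneTo k ++ v) l ≡ 0) last≡z (rsGain-lastOr k (oneTo k ++ v))
    where
    last≡z : lastOr k (oneTo k ++ v) ≡ z
    last≡z = trans (lastOr-++ k (oneTo k) v)
        (trans (cong (λ d → lastOr d v) (lastOr-oneTo k)) (sym (≡ᵇ-true⁻¹ z≡last)))
  ... | false = begin
    rsGain (oneTo k ++ v) z ≡⟨ rsGain-++ (oneTo k) v z (occurs-below-all z v z<v) ⟩
    rsGain (oneTo k) z + rsGain v z ≡⟨ cong₂ _+_ (rsGain-oneTo k z) (rsGain-below-all z v z<v) ⟩
    (k ∸ z) + length v ∎
    where
    z<v : All (z <_) v
    z<v = All.map (<-≤-trans (≤∧≢⇒< z≤last (≡ᵇ-false⁻¹ z≡last))) (descending-≥-last k v (proj₁ split))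

-- lb of the remainder of an RGF whose prefix has exactly the letters 1 ⋯ M.
lbFrom : ℕ → Word → ℕ
lbFrom M [] = 0
lbFrom M (x ∷ xs) = (M ∸ x) + lbFrom (M ⊔ x) xs

lb-go≡lbFrom : ∀ pre w M → distinct pre ≡ oneTo M → isRGF-go M w ≡ true → lb-go pre w ≡ lbFrom M w
lb-go≡lbFrom pre [] M _ _ = refl
lb-go≡lbFrom pre (x ∷ xs) M distinct-pre rgf with ∧-true⁻¹ {1 ≤ᵇ x} rgf
... | 1≤x , rest with ∧-true⁻¹ {x ≤ᵇ suc M} rest
... | x≤1+M , rgf-xs = cong₂ _+_ above (lb-go≡lbFrom (pre ++ [ x ]) xs (M ⊔ x) distinct-pre′ rgf-xs)
  where
  above : length (distinct (filterᵇ (x <ᵇ_) pre)) ≡ M ∸ x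
  above = begin
    length (distinct (filterᵇ (x <ᵇ_) pre)) ≡⟨ cong length (distinct-filterᵇ (x <ᵇ_) pre) ⟩
    length (filterᵇ (x <ᵇ_) (distinct pre)) ≡⟨ cong (length ∘ filterᵇ (x <ᵇ_)) distinct-pre ⟩
    length (filterᵇ (x <ᵇ_) (oneTo M)) ≡⟨ countAbove-oneTo x M ⟩
    M ∸ x ∎
  occurs-pre : occurs x pre ≡ occurs x (oneTo M)
  occurs-pre = trans (sym (occurs-distinct x pre)) (cong (occurs x) distinct-pre)
  distinct-pre′ : distinct (pre ++ [ x ]) ≡ oneTo (M ⊔ x)
  distinct-pre′ rewrite distinct-∷ʳ pre x | distinct-pre | occurs-pre with x ≟ suc M
  ... | yes refl rewrite occurs-oneTo-> (suc M) M ≤-refl | m≤n⇒m⊔n≡n (n≤1+n M) = refl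
  ... | no x≢1+M with ≤-pred (≤∧≢⇒< (≤ᵇ-true⁻¹ x≤1+M) x≢1+M)
  ...   | x≤M rewrite occurs-oneTo x M (≤ᵇ-true⁻¹ 1≤x) x≤M | m≥n⇒m⊔n≡m x≤M = ++-identityʳ (oneTo M)

lb≡lbFrom : ∀ w → isRGF w ≡ true → lb w ≡ lbFrom 0 w
lb≡lbFrom w = lb-go≡lbFrom [] w 0 refl

lbFrom-∷ʳ : ∀ k d v z → d ≤ k → descending d (v ++ [ z ]) ≡ true →
            lbFrom k (v ++ [ z ]) ≡ lbFrom k v + lbCost k (lastOr k v) (length v) z
lbFrom-∷ʳ k d [] z _ _ = +-identityʳ (k ∸ z)
lbFrom-∷ʳ k d (x ∷ v) z d≤k desc with descending-∷⁻ d x (v ++ [ z ]) desc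
... | _ , x≤d , desc-v rewrite m≥n⇒m⊔n≡m (≤-trans x≤d d≤k) =
  trans (cong ((k ∸ x) +_) (lbFrom-∷ʳ k x v z (≤-trans x≤d d≤k) desc-v)) (sym (+-assoc (k ∸ x) _ _))

shift-gauss-0 : ∀ a K → shift a (gauss (a + 0) 0) K ≡ δ a K
shift-gauss-0 a K = begin
  shift a (gauss (a + 0) 0) K ≡⟨ shift-cong a (gauss-0 (a + 0)) K ⟩
  shift a (δ 0) K ≡⟨ shift-δ a 0 K ⟩
  δ (a + 0) K ≡⟨ cong (λ n → δ n K) (+-identityʳ a) ⟩
  δ a K ∎

∸-complement : ∀ y a k → y + a ≡ k → k ∸ y ≡ a
∸-complement y a k refl = m+n∸m≡n y a

rsCost-split : ∀ y a k r i (F : Series) K → suc y + a ≡ k →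
  when (y <ᵇ suc i) (shift (rsCost k (suc i) (suc r) (suc y)) F K)
      ≡ when (i ≡ᵇ y) (F K) + when (y <ᵇ i) (shift (a + suc r) F K)
rsCost-split y a k r i F K 1+y+a≡k with <-cmp i y
... | tri< i<y _ _ rewrite <ᵇ-false {y} {suc i} i<y | ≡ᵇ-false (<⇒≢ i<y) | <ᵇ-false {y} {i} (<⇒≤ i<y) = refl
... | tri≈ _ refl _ rewrite <ᵇ-true (n<1+n i) | ≡ᵇ-refl i | <ᵇ-false {i} {i} ≤-refl = sym (+-identityʳ _)
... | tri> _ _ y<i rewrite <ᵇ-true (m<n⇒m<1+n y<i) | ≡ᵇ-false (<⇒≢ y<i) | ≡ᵇ-false (>⇒≢ y<i) | <ᵇ-true y<i =
  cong (λ s → shift (s + suc r) F K) (∸-complement (suc y) a k 1+y+a≡k)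

module _ (N k : ℕ) (k≤N : k ≤ N) (S : Word → ℕ) (S-[] : S [] ≡ 0) where

  descendingSum-lbCost :
    (∀ v z → descending k (v ++ [ z ]) ≡ true → S (v ++ [ z ]) ≡ S v + lbCost k (lastOr k v) (length v) z) →
    ∀ r K → descendingSum N k S (suc r) K ≡ gauss (k + r) (suc r) K
  descendingSum-lbCost S-∷ʳ r = descendingSum-closed k≤N r (ending-closed r)
    where
    open DescendingSum N k (lbCost k) S S-[] S-∷ʳ

    ending-closed : ∀ r → EndingClosed r
    ending-closed zero a y 1≤y y+a≡k K = begin
      ending 0 y K ≡⟨ ending-zero y K 1≤y (subst (y ≤_) y+a≡k (m≤m+n y a)) ⟩
      δ (k ∸ y) K ≡⟨ cong (λ n → δ n K) (∸-complement y a k y+a≡k) ⟩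
      δ a K ≡⟨ shift-gauss-0 a K ⟨
      shift a (gauss (a + 0) 0) K ∎
    -- The cost k ∸ y of the last letter y does not depend on the letter before it, which is any letter ≥ y.
    ending-closed (suc r) a (suc y) _ y+a≡k K = begin
      ending (suc r) (suc y) K ≡⟨ ending-suc r (suc y) K ⟩
      sumRange N (λ i → when (y <ᵇ suc i) (shift (k ∸ suc y) (ending r (suc i)) K))
        ≡⟨ sumRange-cong N (λ i _ → when-shift (y <ᵇ suc i) (k ∸ suc y) (ending r (suc i)) K) ⟩
      sumRange N (λ i → shift (k ∸ suc y) (λ K′ → when (y <ᵇ suc i) (ending r (suc i) K′)) K)
        ≡⟨ sumRange-shift N (k ∸ suc y) _ K ⟩
      shift (k ∸ suc y) (λ K′ → sumRange N (λ i → when (y <ᵇ suc i) (ending r (suc i) K′))) K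
        ≡⟨ shift-cong (k ∸ suc y) (λ K′ → trans (sumRange-ending k≤N r _ K′)
               (endingAbove-closed r (ending-closed r) (suc a) y (trans (+-suc y a) y+a≡k) K′)) K ⟩
      shift (k ∸ suc y) (gauss (suc a + r) (suc r)) K
        ≡⟨ cong₂ (λ s n → shift s (gauss n (suc r)) K) (∸-complement (suc y) a k y+a≡k) (sym (+-suc a r)) ⟩
      shift a (gauss (a + suc r) (suc r)) K ∎

  descendingSum-rsCost :
    (∀ v z → descending k (v ++ [ z ]) ≡ true → S (v ++ [ z ]) ≡ S v + rsCost k (lastOr k v) (length v) z) →
    ∀ r K → descendingSum N k S (suc r) K ≡ gauss (k + r) (suc r) K
  descendingSum-rsCost S-∷ʳ r = descendingSum-closed k≤N r (ending-closed r)
    where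
    open DescendingSum N k (rsCost k) S S-[] S-∷ʳ

    ending-closed : ∀ r → EndingClosed r
    ending-closed zero a y 1≤y y+a≡k K = begin
      ending 0 y K ≡⟨ ending-zero y K 1≤y (subst (y ≤_) y+a≡k (m≤m+n y a)) ⟩
      δ (rsCost k k 0 y) K ≡⟨ cong (λ n → δ n K) cost≡a ⟩
      δ a K ≡⟨ shift-gauss-0 a K ⟨
      shift a (gauss (a + 0) 0) K ∎
      where
      cost≡a : rsCost k k 0 y ≡ a
      cost≡a with y ≡ᵇ k in y≡k
      ... | true = trans (sym (n∸n≡0 y)) (trans (cong (_∸ y) (≡ᵇ-true⁻¹ y≡k)) (∸-complement y a k y+a≡k))
      ... | false = trans (+-identityʳ (k ∸ y)) (∸-complement y a k y+a≡k)
    -- The last letter y either repeats the letter before it, at no cost, or follows a larger one at cost a + r + 1.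
    ending-closed (suc r) a (suc y) 1≤y y+a≡k K = begin
      ending (suc r) (suc y) K ≡⟨ ending-suc r (suc y) K ⟩
      sumRange N (λ i → when (y <ᵇ suc i) (shift (rsCost k (suc i) (suc r) (suc y)) (ending r (suc i)) K))
        ≡⟨ sumRange-cong N (λ i _ → rsCost-split y a k r i (ending r (suc i)) K y+a≡k) ⟩
      sumRange N (λ i → when (i ≡ᵇ y) (ending r (suc i) K) + when (y <ᵇ i) (shift (a + suc r) (ending r (suc i)) K))
        ≡⟨ sumRange-+ N _ _ ⟩
      sumRange N (λ i → when (i ≡ᵇ y) (ending r (suc i) K))
        + sumRange N (λ i → when (y <ᵇ i) (shift (a + suc r) (ending r (suc i)) K))
        ≡⟨ cong₂ _+_ (sumRange-pick N y (λ i → ending r (suc i) K)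
                                   (<-≤-trans (subst (y <_) y+a≡k (s≤s (m≤m+n y a))) k≤N))
                     (trans (sumRange-cong N (λ i _ → when-shift (y <ᵇ i) (a + suc r) (ending r (suc i)) K))
                            (sumRange-shift N (a + suc r) _ K)) ⟩
      ending r (suc y) K + shift (a + suc r) (λ K′ → sumRange N (λ i → when (y <ᵇ i) (ending r (suc i) K′))) K
        ≡⟨ cong₂ _+_ (ending-closed r a (suc y) 1≤y y+a≡k K)
             (shift-cong (a + suc r) (λ K′ → trans (sumRange-ending k≤N r _ K′)
                 (endingAbove-closed r (ending-closed r) a (suc y) y+a≡k K′)) K) ⟩
      shift a (gauss (a + r) r) K + shift (a + suc r) (gauss (a + r) (suc r)) K
        ≡⟨ cong (shift a (gauss (a + r) r) K +_) (shift-shift a (suc r) _ K) ⟨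
      shift a (gauss (a + r) r) K + shift a (shift (suc r) (gauss (a + r) (suc r))) K ≡⟨ shift-+ a _ _ K ⟨
      shift a (λ K′ → gauss (a + r) r K′ + shift (suc r) (gauss (a + r) (suc r)) K′) K
        ≡⟨ shift-cong a (λ K′ → sym (gauss-pascal (a + r) r K′)) K ⟩
      shift a (gauss (suc (a + r)) (suc r)) K ≡⟨ cong (λ n → shift a (gauss n (suc r)) K) (+-suc a r) ⟨
      shift a (gauss (a + suc r) (suc r)) K ∎

risesThenDescends : ℕ → Word → Bool
risesThenDescends k [] = true
risesThenDescends k (x ∷ xs) = if x ≡ᵇ suc k then risesThenDescends (suc k) xs else descending k (x ∷ xs)

module RisesThenDescendsSum (N : ℕ) (S : ℕ → Word → ℕ)
  (S-[] : ∀ k → S k [] ≡ 0)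
  (S-rise : ∀ k w → S k (suc k ∷ w) ≡ S (suc k) w)
  (descendingSum-gauss : ∀ k → k ≤ N → ∀ r K → descendingSum N k (S k) (suc r) K ≡ gauss (k + r) (suc r) K)
  where

  -- The words u of length r for which 1 ⋯ k u avoids 112, weighted by S k u.
  continuations : ℕ → ℕ → Series
  continuations r k K = sumWords N r (λ u → when (risesThenDescends k u) (δ (S k u) K))

  continuations-suc : ∀ r k K → k < N → continuations (suc r) k K
      ≡ continuations r (suc k) K + descendingSum N k (S k) (suc r) K
  continuations-suc r k K k<N = begin
    continuations (suc r) k K ≡⟨ sumWords-∷ r _ ⟩
    sumRange N (λ i → sumWords N r (λ w → when (risesThenDescends k (suc i ∷ w)) (δ (S k (suc i ∷ w)) K)))
      ≡⟨ sumRange-cong N (λ i _ → trans (sumWords-cong r (λ w _ → split i w)) (sumWords-+ r _ _)) ⟩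
    sumRange N (λ i → sumWords N r (λ w → when (i ≡ᵇ k) (when (risesThenDescends (suc k) w) (δ (S (suc k) w) K)))
                      + sumWords N r (λ w → when (descending k (suc i ∷ w)) (δ (S k (suc i ∷ w)) K)))
      ≡⟨ sumRange-+ N _ _ ⟩
    sumRange N (λ i → sumWords N r (λ w → when (i ≡ᵇ k) (when (risesThenDescends (suc k) w) (δ (S (suc k) w) K))))
      + sumRange N (λ i → sumWords N r (λ w → when (descending k (suc i ∷ w)) (δ (S k (suc i ∷ w)) K)))
      ≡⟨ cong₂ _+_ (trans (sumRange-cong N (λ i _ → sumWords-when r (i ≡ᵇ k) _))
                          (sumRange-pick N k (λ _ → continuations r (suc k) K) k<N))
                   (sym (sumWords-∷ r _)) ⟩
    continuations r (suc k) K + descendingSum N k (S k) (suc r) K ∎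
    where
    split : ∀ i w → when (risesThenDescends k (suc i ∷ w)) (δ (S k (suc i ∷ w)) K)
                  ≡ when (i ≡ᵇ k) (when (risesThenDescends (suc k) w) (δ (S (suc k) w) K))
                    + when (descending k (suc i ∷ w)) (δ (S k (suc i ∷ w)) K)
    split i w with i ≡ᵇ k in i≡k
    ... | false = refl
    ... | true with refl ← ≡ᵇ-true⁻¹ {i} {k} i≡k rewrite <ᵇ-false {k} {k} ≤-refl | S-rise k w = sym (+-identityʳ _)

  continuations-closed : ∀ r k → suc k + r ≤ N → ∀ K → continuations r (suc k) K ≡ gaussSum (r + k) r K
  continuations-closed zero k _ K = begin
    continuations 0 (suc k) K ≡⟨ sumWords-[] {N} (λ u → when (risesThenDescends (suc k) u) (δ (S (suc k) u) K)) ⟩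
    δ (S (suc k) []) K ≡⟨ cong (λ s → δ s K) (S-[] (suc k)) ⟩
    δ 0 K ≡⟨ gauss-0 k K ⟨
    gaussSum (0 + k) 0 K ∎
  continuations-closed (suc r) k 1+k+1+r≤N K = begin
    continuations (suc r) (suc k) K ≡⟨ continuations-suc r (suc k) K (<-≤-trans (s≤s (s≤s (m≤m+n k r))) 2+k+r≤N) ⟩
    continuations r (suc (suc k)) K + descendingSum N (suc k) (S (suc k)) (suc r) K
      ≡⟨ cong₂ _+_ (continuations-closed r (suc k) 2+k+r≤N K) (descendingSum-gauss (suc k) 1+k≤N r K) ⟩
    gaussSum (r + suc k) r K + gauss (suc k + r) (suc r) K
      ≡⟨ cong₂ (λ m n → gaussSum m r K + gauss n (suc r) K) (+-suc r k) (cong suc (+-comm k r)) ⟩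
    gaussSum (suc r + k) r K + gauss (suc r + k) (suc r) K ≡⟨ +-comm (gaussSum (suc r + k) r K) _ ⟩
    gauss (suc r + k) (suc r) K + gaussSum (suc r + k) r K ≡⟨ gaussSum-suc (suc r + k) r K ⟨
    gaussSum (suc r + k) (suc r) K ∎
    where
    2+k+r≤N : suc (suc k) + r ≤ N
    2+k+r≤N = subst (_≤ N) (+-suc (suc k) r) 1+k+1+r≤N
    1+k≤N : suc k ≤ N
    1+k≤N = ≤-trans (m≤m+n (suc k) (suc r)) 1+k+1+r≤N

  continuations-top : ∀ m → N ≡ suc m → ∀ K → continuations (suc m) 0 K ≡ gaussSum m m K
  continuations-top m refl K = begin
    continuations (suc m) 0 K ≡⟨ continuations-suc m 0 K z<s ⟩
    continuations m 1 K + descendingSum N 0 (S 0) (suc m) K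
      ≡⟨ cong₂ _+_ (continuations-closed m 0 ≤-refl K) (descendingSum-gauss 0 z≤n m K) ⟩
    gaussSum (m + 0) m K + gauss m (suc m) K
      ≡⟨ cong₂ (λ n g → gaussSum n m K + g) (+-identityʳ m) (gauss-above m (suc m) ≤-refl K) ⟩
    gaussSum m m K + 0 ≡⟨ +-identityʳ _ ⟩
    gaussSum m m K ∎

StrictlyIncreasing : (ℕ → ℕ) → Set
StrictlyIncreasing f = ∀ {i j} → i < j → f i < f j

module _ {f : ℕ → ℕ} (f-inc : StrictlyIncreasing f) where

  <ᵇ-relabel : ∀ i j → (f i <ᵇ f j) ≡ (i <ᵇ j)
  <ᵇ-relabel i j with <-cmp i j
  ... | tri< i<j _ _ = trans (<ᵇ-true (f-inc i<j)) (sym (<ᵇ-true i<j))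
  ... | tri≈ _ refl _ = trans (<ᵇ-false {f i} ≤-refl) (sym (<ᵇ-false {i} ≤-refl))
  ... | tri> _ _ j<i = trans (<ᵇ-false (<⇒≤ (f-inc j<i))) (sym (<ᵇ-false (<⇒≤ j<i)))

  ≡ᵇ-relabel : ∀ i j → (f i ≡ᵇ f j) ≡ (i ≡ᵇ j)
  ≡ᵇ-relabel i j with <-cmp i j
  ... | tri< i<j _ _ = trans (≡ᵇ-false (<⇒≢ (f-inc i<j))) (sym (≡ᵇ-false (<⇒≢ i<j)))
  ... | tri≈ _ refl _ = trans (≡ᵇ-refl (f i)) (sym (≡ᵇ-refl i))
  ... | tri> _ _ j<i = trans (≡ᵇ-false (>⇒≢ (f-inc j<i))) (sym (≡ᵇ-false (>⇒≢ j<i)))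

  distinct-relabel : ∀ w → distinct (map f w) ≡ map f (distinct w)
  distinct-relabel [] = refl
  distinct-relabel (x ∷ xs) = begin
    distinct (f x ∷ map f xs) ≡⟨ distinct-∷ (f x) (map f xs) ⟩
    f x ∷ filterᵇ (λ y → not (f x ≡ᵇ y)) (distinct (map f xs))
        ≡⟨ cong (λ ds → f x ∷ filterᵇ _ ds) (distinct-relabel xs) ⟩
    f x ∷ filterᵇ (λ y → not (f x ≡ᵇ y)) (map f (distinct xs)) ≡⟨ cong (f x ∷_) (filter-map _ f (distinct xs)) ⟩
    f x ∷ map f (filterᵇ (λ y → not (f x ≡ᵇ f y)) (distinct xs))
      ≡⟨ cong (λ ds → f x ∷ map f ds) (filter-cong _ _ (λ y → cong not (≡ᵇ-relabel x y)) (distinct xs)) ⟩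
    f x ∷ map f (filterᵇ (λ y → not (x ≡ᵇ y)) (distinct xs)) ≡⟨ cong (map f) (distinct-∷ x xs) ⟨
    map f (distinct (x ∷ xs)) ∎

  std-relabel : ∀ w → std (map f w) ≡ std w
  std-relabel w = begin
    map (rank (map f w)) (map f w) ≡⟨ map-∘ w ⟨
    map (rank (map f w) ∘ f) w ≡⟨ map-cong rank-relabel w ⟩
    map (rank w) w ∎
    where
    rank : Word → ℕ → ℕ
    rank w x = suc (length (filterᵇ (λ y → y <ᵇ x) (distinct w)))
    rank-relabel : ∀ x → rank (map f w) (f x) ≡ rank w x
    rank-relabel x = cong suc (begin
      length (filterᵇ (λ y → y <ᵇ f x) (distinct (map f w))) ≡⟨ cong (length ∘ filterᵇ _) (distinct-relabel w) ⟩
      length (filterᵇ (λ y → y <ᵇ f x) (map f (distinct w))) ≡⟨ cong length (filter-map _ f (distinct w)) ⟩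
      length (map f (filterᵇ (λ y → f y <ᵇ f x) (distinct w)))
          ≡⟨ length-map f (filterᵇ (λ y → f y <ᵇ f x) (distinct w)) ⟩
      length (filterᵇ (λ y → f y <ᵇ f x) (distinct w))
          ≡⟨ cong length (filter-cong _ _ (λ y → <ᵇ-relabel y x) (distinct w)) ⟩
      length (filterᵇ (λ y → y <ᵇ x) (distinct w)) ∎)

spread₁ : ℕ → ℕ → ℕ
spread₁ u i = i + u

spread₂ : ℕ → ℕ → ℕ → ℕ
spread₂ u v zero = u
spread₂ u v (suc i) = i + v

spread₃ : ℕ → ℕ → ℕ → ℕ → ℕ
spread₃ u v w zero = u
spread₃ u v w (suc zero) = v
spread₃ u v w (suc (suc i)) = i + w

spread₁-increasing : ∀ u → StrictlyIncreasing (spread₁ u)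
spread₁-increasing u = +-monoˡ-< u

spread₂-increasing : ∀ {u v} → u < v → StrictlyIncreasing (spread₂ u v)
spread₂-increasing {u} {v} u<v {zero} {suc j} _ = <-≤-trans u<v (m≤n+m v j)
spread₂-increasing {u} {v} u<v {suc i} {suc j} (s≤s i<j) = +-monoˡ-< v i<j

spread₃-increasing : ∀ {u v w} → u < v → v < w → StrictlyIncreasing (spread₃ u v w)
spread₃-increasing u<v v<w {zero} {suc zero} _ = u<v
spread₃-increasing {w = w} u<v v<w {zero} {suc (suc j)} _ = <-trans u<v (<-≤-trans v<w (m≤n+m w j))
spread₃-increasing {w = w} u<v v<w {suc zero} {suc (suc j)} _ = <-≤-trans v<w (m≤n+m w j)
spread₃-increasing u<v v<w {suc zero} {suc zero} (s≤s ())
spread₃-increasing {w = w} u<v v<w {suc (suc i)} {suc (suc j)} (s≤s (s≤s i<j)) = +-monoˡ-< w i<j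

record Relabelling (x y z : ℕ) : Set where
  constructor relabelling
  field
    f : ℕ → ℕ
    f-increasing : StrictlyIncreasing f
    a b c : Fin 3
    relabels : map f (toℕ a ∷ toℕ b ∷ toℕ c ∷ []) ≡ x ∷ y ∷ z ∷ []

relabel : ∀ x y z → Relabelling x y z
relabel x y z with <-cmp x y | <-cmp y z | <-cmp x z
... | tri< x<y _ _ | tri< y<z _ _ | _            = relabelling (spread₃ x y z) (spread₃-increasing x<y y<z) 0F 1F 2F refl
... | tri< x<y _ _ | tri≈ _ refl _ | _           = relabelling (spread₂ x y) (spread₂-increasing x<y) 0F 1F 1F refl
... | tri< _ _ _   | tri> _ _ z<y | tri< x<z _ _ = relabelling (spread₃ x z y) (spread₃-increasing x<z z<y) 0F 2F 1F refl
... | tri< x<y _ _ | tri> _ _ _   | tri≈ _ refl _ = relabelling (spread₂ x y) (spread₂-increasing x<y) 0F 1F 0F refl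
... | tri< x<y _ _ | tri> _ _ _   | tri> _ _ z<x = relabelling (spread₃ z x y) (spread₃-increasing z<x x<y) 1F 2F 0F refl
... | tri≈ _ refl _ | _ | tri< x<z _ _           = relabelling (spread₂ x z) (spread₂-increasing x<z) 0F 0F 1F refl
... | tri≈ _ refl _ | _ | tri≈ _ refl _          = relabelling (spread₁ x) (spread₁-increasing x) 0F 0F 0F refl
... | tri≈ _ refl _ | _ | tri> _ _ z<x           = relabelling (spread₂ z x) (spread₂-increasing z<x) 1F 1F 0F refl
... | tri> _ _ y<x | tri≈ _ refl _ | _           = relabelling (spread₂ y x) (spread₂-increasing y<x) 1F 0F 0F refl
... | tri> _ _ y<x | tri> _ _ z<y | _            = relabelling (spread₃ z y x) (spread₃-increasing z<y y<x) 2F 1F 0F refl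
... | tri> _ _ y<x | tri< _ _ _   | tri< x<z _ _ = relabelling (spread₃ y x z) (spread₃-increasing y<x x<z) 1F 0F 2F refl
... | tri> _ _ y<x | tri< _ _ _   | tri≈ _ refl _ = relabelling (spread₂ y x) (spread₂-increasing y<x) 1F 0F 1F refl
... | tri> _ _ _   | tri< y<z _ _ | tri> _ _ z<x = relabelling (spread₃ y z x) (spread₃-increasing y<z z<x) 2F 0F 1F refl

-- Since std is invariant under such relabellings, a pattern of length 3 is decided by the 27 triples over {0, 1, 2}.
std-triple : (v : Word) (R : ℕ → ℕ → ℕ → Bool) →
  (∀ {f} → StrictlyIncreasing f → ∀ a b c → R (f a) (f b) (f c) ≡ R a b c) →
  (∀ (a b c : Fin 3) → eqWord (std (toℕ a ∷ toℕ b ∷ toℕ c ∷ [])) v ≡ R (toℕ a) (toℕ b) (toℕ c)) →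
  ∀ x y z → eqWord (std (x ∷ y ∷ z ∷ [])) v ≡ R x y z
std-triple v R R-relabel small x y z with relabel x y z
... | relabelling f f-inc a b c refl = begin
  eqWord (std (map f (toℕ a ∷ toℕ b ∷ toℕ c ∷ []))) v
    ≡⟨ cong (λ s → eqWord s v) (std-relabel f-inc (toℕ a ∷ toℕ b ∷ toℕ c ∷ [])) ⟩
  eqWord (std (toℕ a ∷ toℕ b ∷ toℕ c ∷ [])) v ≡⟨ small a b c ⟩
  R (toℕ a) (toℕ b) (toℕ c) ≡⟨ R-relabel f-inc _ _ _ ⟨
  R (f (toℕ a)) (f (toℕ b)) (f (toℕ c)) ∎

std-112 : ∀ x y z → eqWord (std (x ∷ y ∷ z ∷ [])) w112 ≡ (x ≡ᵇ y) ∧ (y <ᵇ z)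
std-112 = std-triple w112 (λ x y z → (x ≡ᵇ y) ∧ (y <ᵇ z))
  (λ f-inc a b c → cong₂ _∧_ (≡ᵇ-relabel f-inc a b) (<ᵇ-relabel f-inc b c))
  (from-yes (all? λ (a : Fin 3) → all? λ (b : Fin 3) → all? λ (c : Fin 3) →
    eqWord (std (toℕ a ∷ toℕ b ∷ toℕ c ∷ [])) w112 Bool.≟ ((toℕ a ≡ᵇ toℕ b) ∧ (toℕ b <ᵇ toℕ c))))

std-122 : ∀ x y z → eqWord (std (x ∷ y ∷ z ∷ [])) w122 ≡ (x <ᵇ y) ∧ (y ≡ᵇ z)
std-122 = std-triple w122 (λ x y z → (x <ᵇ y) ∧ (y ≡ᵇ z))
  (λ f-inc a b c → cong₂ _∧_ (<ᵇ-relabel f-inc a b) (≡ᵇ-relabel f-inc b c))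
  (from-yes (all? λ (a : Fin 3) → all? λ (b : Fin 3) → all? λ (c : Fin 3) →
    eqWord (std (toℕ a ∷ toℕ b ∷ toℕ c ∷ [])) w122 Bool.≟ ((toℕ a <ᵇ toℕ b) ∧ (toℕ b ≡ᵇ toℕ c))))

any-++ : ∀ (f : A → Bool) xs ys → any f (xs ++ ys) ≡ any f xs ∨ any f ys
any-++ f [] ys = refl
any-++ f (x ∷ xs) ys = trans (cong (f x ∨_) (any-++ f xs ys)) (sym (∨-assoc (f x) _ _))

any-map : ∀ (f : B → Bool) (g : A → B) xs → any f (map g xs) ≡ any (f ∘ g) xs
any-map f g [] = refl
any-map f g (x ∷ xs) = cong (f (g x) ∨_) (any-map f g xs)

any-false : ∀ (f : A → Bool) xs → (∀ x → f x ≡ false) → any f xs ≡ false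
any-false f [] _ = refl
any-false f (x ∷ xs) f≡false rewrite f≡false x = any-false f xs f≡false

any-cong : ∀ {f g : A → Bool} xs → f ≗ g → any f xs ≡ any g xs
any-cong [] _ = refl
any-cong (x ∷ xs) f≗g = cong₂ _∨_ (f≗g x) (any-cong xs f≗g)

any-∧ : ∀ b (f : A → Bool) xs → any (λ x → b ∧ f x) xs ≡ b ∧ any f xs
any-∧ true f xs = refl
any-∧ false f xs = any-false _ xs (λ _ → refl)

any-mono : ∀ {f g : A → Bool} xs → (∀ x → f x ≡ true → g x ≡ true) → any f xs ≡ true → any g xs ≡ true
any-mono {f = f} {g} (x ∷ xs) f⇒g any-f with f x in fx | g x in gx
... | true | _ = cong (_∨ any g xs) (trans (sym gx) (f⇒g x fx))
... | false | true = refl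
... | false | false = any-mono xs f⇒g any-f

any-subwords-∷ : ∀ (f : Word → Bool) x xs → any f (subwords (x ∷ xs))
    ≡ any (f ∘ (x ∷_)) (subwords xs) ∨ any f (subwords xs)
any-subwords-∷ f x xs = trans (any-++ f (map (x ∷_) (subwords xs)) (subwords xs))
    (cong (_∨ any f (subwords xs)) (any-map f (x ∷_) (subwords xs)))

any-subwords-[] : ∀ (f : Word → Bool) xs → (∀ y s → f (y ∷ s) ≡ false) → any f (subwords xs) ≡ f []
any-subwords-[] f [] _ = ∨-identityʳ (f [])
any-subwords-[] f (y ∷ ys) f∷≡false = begin
  any f (subwords (y ∷ ys)) ≡⟨ any-subwords-∷ f y ys ⟩
  any (f ∘ (y ∷_)) (subwords ys) ∨ any f (subwords ys)
    ≡⟨ cong₂ _∨_ (any-false _ (subwords ys) (f∷≡false y)) (any-subwords-[] f ys f∷≡false) ⟩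
  f [] ∎

hasPair : (ℕ → ℕ → Bool) → Word → Bool
hasPair Q [] = false
hasPair Q (y ∷ ys) = any (Q y) ys ∨ hasPair Q ys

hasTriple : (ℕ → ℕ → ℕ → Bool) → Word → Bool
hasTriple P [] = false
hasTriple P (x ∷ xs) = hasPair (P x) xs ∨ hasTriple P xs

eqWord-length : ∀ (u v : Word) → length u ≢ length v → eqWord u v ≡ false
eqWord-length [] [] ≢ = ⊥-elim (≢ refl)
eqWord-length [] (_ ∷ _) _ = refl
eqWord-length (_ ∷ _) [] _ = refl
eqWord-length (a ∷ u) (b ∷ v) ≢ rewrite eqWord-length u v (≢ ∘ cong suc) = ∧-zeroʳ (a ≡ᵇ b)

module _ (a b c : ℕ) where

  private
    matches : Word → Bool
    matches s = eqWord (std s) (a ∷ b ∷ c ∷ [])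

    matches-length : ∀ s → length s ≢ 3 → matches s ≡ false
    matches-length s ≢3 = eqWord-length (std s) _ (≢3 ∘ trans (sym (length-map _ s)))

    matches₃ : ℕ → ℕ → ℕ → Bool
    matches₃ x y z = matches (x ∷ y ∷ z ∷ [])

    third : ∀ x y zs → any (matches ∘ (λ s → x ∷ y ∷ s)) (subwords zs) ≡ any (matches₃ x y) zs
    third x y [] = trans (∨-identityʳ _) (matches-length (x ∷ y ∷ []) λ ())
    third x y (z ∷ zs) = trans (any-subwords-∷ _ z zs)
      (cong₂ _∨_ (any-subwords-[] _ zs (λ t s → matches-length (x ∷ y ∷ z ∷ t ∷ s) λ ())) (third x y zs))

    second : ∀ x ys → any (matches ∘ (x ∷_)) (subwords ys) ≡ hasPair (matches₃ x) ys
    second x [] = trans (∨-identityʳ _) (matches-length (x ∷ []) λ ())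
    second x (y ∷ ys) = trans (any-subwords-∷ _ y ys) (cong₂ _∨_ (third x y ys) (second x ys))

  contains-triple : ∀ w → contains w (a ∷ b ∷ c ∷ [])
      ≡ hasTriple (λ x y z → eqWord (std (x ∷ y ∷ z ∷ [])) (a ∷ b ∷ c ∷ [])) w
  contains-triple [] = refl
  contains-triple (x ∷ xs) = trans (any-subwords-∷ matches x xs) (cong₂ _∨_ (second x xs) (contains-triple xs))

hasPair-cong : ∀ {Q Q′ : ℕ → ℕ → Bool} xs → (∀ y z → Q y z ≡ Q′ y z) → hasPair Q xs ≡ hasPair Q′ xs
hasPair-cong [] _ = refl
hasPair-cong (y ∷ ys) Q≗Q′ = cong₂ _∨_ (any-cong ys (Q≗Q′ y)) (hasPair-cong ys Q≗Q′)

hasTriple-cong : ∀ {P P′ : ℕ → ℕ → ℕ → Bool} xs → (∀ x y z → P x y z ≡ P′ x y z) → hasTriple P xs ≡ hasTriple P′ xs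
hasTriple-cong [] _ = refl
hasTriple-cong (x ∷ xs) P≗P′ = cong₂ _∨_ (hasPair-cong xs (P≗P′ x)) (hasTriple-cong xs P≗P′)

avoids≡not-contains : ∀ w v → avoids w v ≡ not (contains w v)
avoids≡not-contains w v with contains w v
... | true = refl
... | false = refl

avoids-triple : ∀ a b c (R : ℕ → ℕ → ℕ → Bool)
    → (∀ x y z → eqWord (std (x ∷ y ∷ z ∷ [])) (a ∷ b ∷ c ∷ []) ≡ R x y z) →
  ∀ w → avoids w (a ∷ b ∷ c ∷ []) ≡ not (hasTriple R w)
avoids-triple a b c R std≡R w =
  trans (avoids≡not-contains w _) (cong not (trans (contains-triple a b c w) (hasTriple-cong w std≡R)))

repeatRise : ℕ → ℕ → ℕ → Bool
repeatRise x y z = (x ≡ᵇ y) ∧ (y <ᵇ z)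

avoids-112 : ∀ w → avoids w w112 ≡ not (hasTriple repeatRise w)
avoids-112 = avoids-triple 1 1 2 repeatRise std-112

-- An occurrence of 112 in 1 ⋯ k u whose first letter lies in the prefix 1 ⋯ k.
prefixLetterRises : ℕ → Word → Bool
prefixLetterRises k [] = false
prefixLetterRises k (y ∷ ys) = ((1 ≤ᵇ y) ∧ (y ≤ᵇ k) ∧ any (y <ᵇ_) ys) ∨ prefixLetterRises k ys

prefixLetterRises-0 : ∀ u → prefixLetterRises 0 u ≡ false
prefixLetterRises-0 [] = refl
prefixLetterRises-0 (zero ∷ ys) = prefixLetterRises-0 ys
prefixLetterRises-0 (suc y ∷ ys) = prefixLetterRises-0 ys

descending-weaken : ∀ {y z} zs → z ≤ y → descending z zs ≡ true → descending y zs ≡ true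
descending-weaken [] _ _ = refl
descending-weaken {y} {z} (t ∷ ts) z≤y desc with descending-∷⁻ z t ts desc
... | 1≤t , t≤z , desc-ts = descending-∷⁺ ts 1≤t (≤-trans t≤z z≤y) desc-ts

descending-no-rise : ∀ {y} ys → descending y ys ≡ true → any (y <ᵇ_) ys ≡ false
descending-no-rise [] _ = refl
descending-no-rise {y} (t ∷ ts) desc with descending-∷⁻ y t ts desc
... | _ , t≤y , desc-ts rewrite <ᵇ-false t≤y = descending-no-rise ts (descending-weaken ts t≤y desc-ts)

descending-no-repeatRise : ∀ {x} x′ xs → descending x xs ≡ true → hasPair (repeatRise x′) xs ≡ false
descending-no-repeatRise x′ [] _ = refl
descending-no-repeatRise {x} x′ (y ∷ ys) desc with descending-∷⁻ x y ys desc
... | _ , _ , desc-ys = begin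
  any (λ z → (x′ ≡ᵇ y) ∧ (y <ᵇ z)) ys ∨ hasPair (repeatRise x′) ys
    ≡⟨ cong₂ _∨_ (any-∧ (x′ ≡ᵇ y) (y <ᵇ_) ys) (descending-no-repeatRise x′ ys desc-ys) ⟩
  ((x′ ≡ᵇ y) ∧ any (y <ᵇ_) ys) ∨ false ≡⟨ cong (λ b → ((x′ ≡ᵇ y) ∧ b) ∨ false) (descending-no-rise ys desc-ys) ⟩
  ((x′ ≡ᵇ y) ∧ false) ∨ false ≡⟨ cong (_∨ false) (∧-zeroʳ (x′ ≡ᵇ y)) ⟩
  false ∎

descending-avoids-112 : ∀ {x} xs → descending x xs ≡ true → hasTriple repeatRise xs ≡ false
descending-avoids-112 [] _ = refl
descending-avoids-112 {x} (y ∷ ys) desc with descending-∷⁻ x y ys desc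
... | _ , _ , desc-ys = cong₂ _∨_ (descending-no-repeatRise y ys desc-ys) (descending-avoids-112 ys desc-ys)

∨-absorbs : ∀ {a b} c → (a ≡ true → b ≡ true) → a ∨ (b ∨ c) ≡ b ∨ c
∨-absorbs {false} c _ = refl
∨-absorbs {true} c a⇒b rewrite a⇒b refl = refl

isRGF-go∧no-rise≡descending : ∀ k x xs → x ≤ k →
  isRGF-go k xs ∧ not (any (x <ᵇ_) xs ∨ prefixLetterRises k xs) ≡ descending x xs
isRGF-go∧no-rise≡descending k x [] _ = refl
isRGF-go∧no-rise≡descending k x (zero ∷ ys) _ = refl
isRGF-go∧no-rise≡descending k x (suc y ∷ ys) x≤k with x <ᵇ suc y in x<1+y
... | true rewrite ≤ᵇ-false {suc y} {x} (<ᵇ-true⁻¹ x<1+y) = ∧-zeroʳ _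
... | false with <ᵇ-false⁻¹ x<1+y
...   | 1+y≤x with ≤-trans 1+y≤x x≤k
...     | 1+y≤k rewrite ≤ᵇ-true {suc y} {suc k} (m≤n⇒m≤1+n 1+y≤k) | ≤ᵇ-true 1+y≤k | ≤ᵇ-true 1+y≤x | m≥n⇒m⊔n≡m 1+y≤k =
  trans (cong (λ b → isRGF-go k ys ∧ not b)
      (∨-absorbs (prefixLetterRises k ys)
          (any-mono ys (λ z x<z → <ᵇ-true (≤-<-trans 1+y≤x (<ᵇ-true⁻¹ {x} {z} x<z))))))
        (isRGF-go∧no-rise≡descending k (suc y) ys 1+y≤k)

prefixLetterRises-suc : ∀ k xs → prefixLetterRises (suc k) xs
    ≡ prefixLetterRises k xs ∨ hasPair (repeatRise (suc k)) xs
prefixLetterRises-suc k [] = refl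
prefixLetterRises-suc k (y ∷ ys) rewrite prefixLetterRises-suc k ys | any-∧ (suc k ≡ᵇ y) (y <ᵇ_) ys with y
... | zero = refl
... | suc y with <-cmp y k
...   | tri< y<k _ _ rewrite ≤ᵇ-true {suc y} {suc k} (s≤s (<⇒≤ y<k)) | ≤ᵇ-true y<k | ≡ᵇ-false (>⇒≢ y<k) =
  sym (∨-assoc (any (suc y <ᵇ_) ys) _ _)
...   | tri≈ _ refl _ rewrite ≤ᵇ-true {suc y} {suc y} ≤-refl | ≤ᵇ-false {suc y} {y} ≤-refl | ≡ᵇ-refl y =
  ∨-x∙yz≈y∙xz (any (suc y <ᵇ_) ys) (prefixLetterRises y ys) (hasPair (repeatRise (suc y)) ys)
...   | tri> _ _ k<y rewrite ≤ᵇ-false {suc y} {suc k} (s≤s k<y) | ≤ᵇ-false {suc y} {k} (m<n⇒m<1+n k<y)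
                           | ≡ᵇ-false (<⇒≢ k<y) = refl

∧-not-∨ : ∀ a b c → a ∧ not c ≡ false → a ∧ not (b ∨ c) ≡ false
∧-not-∨ false b c _ = refl
∧-not-∨ true true c _ = refl
∧-not-∨ true false c a∧¬c = a∧¬c

isRGF-go∧avoids-112≡risesThenDescends : ∀ k u →
  isRGF-go k u ∧ not (hasTriple repeatRise u ∨ prefixLetterRises k u) ≡ risesThenDescends k u
isRGF-go∧avoids-112≡risesThenDescends k [] = refl
isRGF-go∧avoids-112≡risesThenDescends k (zero ∷ xs) = refl
isRGF-go∧avoids-112≡risesThenDescends k (suc x ∷ xs) with <-cmp x k
... | tri≈ _ refl _ rewrite ≡ᵇ-refl x | ≤ᵇ-true {suc x} {suc x} ≤-refl | ≤ᵇ-false {suc x} {x} ≤-refl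
        | m≤n⇒m⊔n≡n (n≤1+n x)
        | sym (isRGF-go∧avoids-112≡risesThenDescends (suc x) xs) | prefixLetterRises-suc x xs =
  cong (λ b → isRGF-go (suc x) xs ∧ not b) (∨-xy∙z≈y∙zx (hasPair (repeatRise (suc x)) xs) _ _)
... | tri> _ _ k<x rewrite ≤ᵇ-false {suc x} {suc k} (s≤s k<x) | ≡ᵇ-false (>⇒≢ k<x)
        | ≤ᵇ-false {suc x} {k} (m<n⇒m<1+n k<x) = refl
... | tri< x<k _ _ rewrite ≤ᵇ-true {suc x} {suc k} (s≤s (<⇒≤ x<k)) | ≤ᵇ-true x<k | ≡ᵇ-false (<⇒≢ x<k) | m≥n⇒m⊔n≡m x<k
  with descending (suc x) xs in desc
...   | true rewrite descending-no-repeatRise (suc x) xs desc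
    | descending-avoids-112 xs desc = trans (isRGF-go∧no-rise≡descending k (suc x) xs x<k) desc
...   | false = ∧-not-∨ (isRGF-go k xs) (hasPair (repeatRise (suc x)) xs ∨ hasTriple repeatRise xs) _
    (trans (isRGF-go∧no-rise≡descending k (suc x) xs x<k) desc)

isRGF∧avoids-112≡risesThenDescends : ∀ w → isRGF w ∧ avoids w w112 ≡ risesThenDescends 0 w
isRGF∧avoids-112≡risesThenDescends w = begin
  isRGF-go 0 w ∧ avoids w w112 ≡⟨ cong (isRGF-go 0 w ∧_) (avoids-112 w) ⟩
  isRGF-go 0 w ∧ not (hasTriple repeatRise w) ≡⟨ cong (λ b → isRGF-go 0 w ∧ not b) (∨-identityʳ _) ⟨
  isRGF-go 0 w ∧ not (hasTriple repeatRise w ∨ false)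
    ≡⟨ cong (λ b → isRGF-go 0 w ∧ not (hasTriple repeatRise w ∨ b)) (prefixLetterRises-0 w) ⟨
  isRGF-go 0 w ∧ not (hasTriple repeatRise w ∨ prefixLetterRises 0 w) ≡⟨ isRGF-go∧avoids-112≡risesThenDescends 0 w ⟩
  risesThenDescends 0 w ∎

onesAndRecords : ℕ → Word → Bool
onesAndRecords M [] = true
onesAndRecords M (x ∷ xs) = if x ≡ᵇ suc M then onesAndRecords (suc M) xs else (x ≡ᵇ 1) ∧ onesAndRecords M xs

riseRepeat : ℕ → ℕ → ℕ → Bool
riseRepeat x y z = (x <ᵇ y) ∧ (y ≡ᵇ z)

avoids-122 : ∀ w → avoids w w122 ≡ not (hasTriple riseRepeat w)
avoids-122 = avoids-triple 1 2 2 riseRepeat std-122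

hasPair-mono : ∀ {Q Q′ : ℕ → ℕ → Bool} xs → (∀ y z → Q y z ≡ true → Q′ y z ≡ true) → hasPair Q xs ≡ true
    → hasPair Q′ xs ≡ true
hasPair-mono {Q} {Q′} (y ∷ ys) Q⇒Q′ pair with any (Q y) ys in q
... | true rewrite any-mono ys (Q⇒Q′ y) q = refl
... | false rewrite hasPair-mono ys Q⇒Q′ pair = ∨-zeroʳ _

riseRepeat-from-1 : ∀ x → 1 ≤ x → ∀ y z → riseRepeat x y z ≡ true → riseRepeat 1 y z ≡ true
riseRepeat-from-1 x 1≤x y z rr with x <ᵇ y in x<y | y ≡ᵇ z
... | true | true rewrite <ᵇ-true (<-≤-trans (s≤s 1≤x) (<ᵇ-true⁻¹ {x} {y} x<y)) = refl

-- The occurrences of 122 in w u, for an RGF w with maximum M, that use two letters of w; those using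
-- only the 1 of w are counted by hasPair (riseRepeat 1) u.
hasOldLetter : ℕ → Word → Bool
hasOldLetter M [] = false
hasOldLetter M (y ∷ ys) = ((1 <ᵇ y) ∧ (y ≤ᵇ M)) ∨ hasOldLetter M ys

hasOldLetter-1 : ∀ u → hasOldLetter 1 u ≡ false
hasOldLetter-1 [] = refl
hasOldLetter-1 (zero ∷ ys) = hasOldLetter-1 ys
hasOldLetter-1 (suc zero ∷ ys) = hasOldLetter-1 ys
hasOldLetter-1 (suc (suc y) ∷ ys) = hasOldLetter-1 ys

hasOldLetter-suc : ∀ M → 1 ≤ M → ∀ u → hasOldLetter (suc M) u ≡ hasOldLetter M u ∨ any (suc M ≡ᵇ_) u
hasOldLetter-suc M 1≤M [] = refl
hasOldLetter-suc M 1≤M (y ∷ ys) rewrite hasOldLetter-suc M 1≤M ys with <-cmp y (suc M)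
... | tri< y<1+M _ _ rewrite ≤ᵇ-true {y} {suc M} (<⇒≤ y<1+M) | ≤ᵇ-true {y} {M} (≤-pred y<1+M) | ≡ᵇ-false (>⇒≢ y<1+M) =
  sym (∨-assoc ((1 <ᵇ y) ∧ true) _ _)
... | tri≈ _ refl _ rewrite ≤ᵇ-true {suc M} {suc M} ≤-refl | ≤ᵇ-false {suc M} {M} ≤-refl | ≡ᵇ-refl M
                          | <ᵇ-true {1} {suc M} (s≤s 1≤M) =
  sym (∨-zeroʳ (hasOldLetter M ys))
... | tri> _ _ 1+M<y rewrite ≤ᵇ-false {y} {suc M} 1+M<y | ≤ᵇ-false {y} {M} (<-trans (n<1+n M) 1+M<y)
                            | ≡ᵇ-false (<⇒≢ 1+M<y) | ∧-zeroʳ (1 <ᵇ y) = refl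

isRGF-go∧avoids-122≡onesAndRecords : ∀ M → 1 ≤ M → ∀ u →
  isRGF-go M u ∧ not (hasTriple riseRepeat u ∨ (hasPair (riseRepeat 1) u ∨ hasOldLetter M u)) ≡ onesAndRecords M u
isRGF-go∧avoids-122≡onesAndRecords M 1≤M [] = refl
isRGF-go∧avoids-122≡onesAndRecords M 1≤M (zero ∷ xs) = refl
isRGF-go∧avoids-122≡onesAndRecords M 1≤M (suc zero ∷ xs)
  rewrite ≤ᵇ-true {1} {suc M} (s≤s z≤n) | m≥n⇒m⊔n≡m 1≤M | ≡ᵇ-false {0} {M} (<⇒≢ 1≤M)
        | any-false (λ _ → false) xs (λ _ → refl) | sym (isRGF-go∧avoids-122≡onesAndRecords M 1≤M xs) =
  cong (λ b → isRGF-go M xs ∧ not b) (repeated (hasPair (riseRepeat 1) xs) _ _)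
  where
  repeated : ∀ r t h → (r ∨ t) ∨ (r ∨ h) ≡ t ∨ (r ∨ h)
  repeated true t h = sym (∨-zeroʳ t)
  repeated false t h = refl
isRGF-go∧avoids-122≡onesAndRecords M 1≤M (suc (suc x) ∷ xs) with <-cmp (suc x) M
... | tri< 2+x≤M _ _ rewrite ≤ᵇ-true {suc (suc x)} {suc M} (m≤n⇒m≤1+n 2+x≤M) | ≤ᵇ-true 2+x≤M | ≡ᵇ-false (<⇒≢ 2+x≤M) =
  old-letter (isRGF-go (M ⊔ suc (suc x)) xs) (hasTriple riseRepeat (suc (suc x) ∷ xs))
      (any (suc (suc x) ≡ᵇ_) xs ∨ hasPair (riseRepeat 1) xs)
  where
  old-letter : ∀ a b c → a ∧ not (b ∨ (c ∨ true)) ≡ false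
  old-letter a b c rewrite ∨-zeroʳ c | ∨-zeroʳ b = ∧-zeroʳ a
... | tri> _ _ M<1+x rewrite ≤ᵇ-false {suc (suc x)} {suc M} (s≤s M<1+x) | ≡ᵇ-false (>⇒≢ M<1+x) = refl
... | tri≈ _ refl _ rewrite ≤ᵇ-true {suc (suc x)} {suc (suc x)} ≤-refl | m≤n⇒m⊔n≡n (n≤1+n (suc x)) | ≡ᵇ-refl x
                          | ≤ᵇ-false {suc (suc x)} {suc x} ≤-refl
                          | sym (isRGF-go∧avoids-122≡onesAndRecords (suc (suc x)) (s≤s z≤n) xs)
                          | hasOldLetter-suc (suc x) (s≤s z≤n) xs =
  cong (λ b → isRGF-go (suc (suc x)) xs ∧ not b)
    (rearrange (hasPair (riseRepeat (suc (suc x))) xs) (hasTriple riseRepeat xs) (any (suc (suc x) ≡ᵇ_) xs)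
               (hasPair (riseRepeat 1) xs) (hasOldLetter (suc x) xs)
               (hasPair-mono xs (riseRepeat-from-1 (suc (suc x)) (s≤s z≤n))))
  where
  rearrange : ∀ p t a r h → (p ≡ true → r ≡ true) → (p ∨ t) ∨ ((a ∨ r) ∨ h) ≡ t ∨ (r ∨ (h ∨ a))
  rearrange true t a r h p⇒r rewrite p⇒r refl = sym (∨-zeroʳ t)
  rearrange false t a r h _ = cong (t ∨_) (∨-xy∙z≈y∙zx a r h)

isRGF∧avoids-122≡onesAndRecords : ∀ w → isRGF w ∧ avoids w w122 ≡ onesAndRecords 0 w
isRGF∧avoids-122≡onesAndRecords [] = refl
isRGF∧avoids-122≡onesAndRecords (zero ∷ xs) = refl
isRGF∧avoids-122≡onesAndRecords (suc (suc x) ∷ xs) = refl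
isRGF∧avoids-122≡onesAndRecords (suc zero ∷ xs) rewrite avoids-122 (suc zero ∷ xs)
    | sym (isRGF-go∧avoids-122≡onesAndRecords 1 ≤-refl xs)
    | hasOldLetter-1 xs =
  cong (λ b → isRGF-go 1 xs ∧ not b) (trans (∨-comm (hasPair (riseRepeat 1) xs) _)
      (cong (hasTriple riseRepeat xs ∨_) (sym (∨-identityʳ _))))

gaussPowerSum : ℕ → ℕ → Series
gaussPowerSum r c K = sumRange (suc r) (λ z → shift (c * z) (gauss r z) K)

gaussPowerSum-suc : ∀ r c K → gaussPowerSum (suc r) c K ≡ shift c (gaussPowerSum r c) K + gaussPowerSum r (suc c) K
gaussPowerSum-suc r c K = begin
  gaussPowerSum (suc r) c K ≡⟨ sumRange-unfoldˡ (suc r) _ ⟩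
  shift (c * 0) (gauss (suc r) 0) K + sumRange (suc r) (λ z → shift (c * suc z) (gauss (suc r) (suc z)) K)
    ≡⟨ cong₂ _+_ first (trans (sumRange-cong (suc r) (λ z _ → term z)) (sumRange-+ (suc r) _ _)) ⟩
  δ 0 K + (sumRange (suc r) (λ z → shift c (shift (c * z) (gauss r z)) K) + rest)
    ≡⟨ cong (λ t → δ 0 K + (t + rest)) (sumRange-shift (suc r) c (λ z → shift (c * z) (gauss r z)) K) ⟩
  δ 0 K + (shift c (gaussPowerSum r c) K + rest) ≡⟨ +-x∙yz≈y∙xz (δ 0 K) (shift c (gaussPowerSum r c) K) rest ⟩
  shift c (gaussPowerSum r c) K + (δ 0 K + rest) ≡⟨ cong (shift c (gaussPowerSum r c) K +_) last ⟩
  shift c (gaussPowerSum r c) K + gaussPowerSum r (suc c) K ∎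
  where
  rest : ℕ
  rest = sumRange (suc r) (λ z → shift (suc c * suc z) (gauss r (suc z)) K)
  first : shift (c * 0) (gauss (suc r) 0) K ≡ δ 0 K
  first rewrite *-zeroʳ c = gauss-0 (suc r) K
  term : ∀ z → shift (c * suc z) (gauss (suc r) (suc z)) K
      ≡ shift c (shift (c * z) (gauss r z)) K + shift (suc c * suc z) (gauss r (suc z)) K
  term z = begin
    shift (c * suc z) (gauss (suc r) (suc z)) K ≡⟨ shift-cong (c * suc z) (gauss-pascal r z) K ⟩
    shift (c * suc z) (λ K′ → gauss r z K′ + shift (suc z) (gauss r (suc z)) K′) K ≡⟨ shift-+ (c * suc z) _ _ K ⟩
    shift (c * suc z) (gauss r z) K + shift (c * suc z) (shift (suc z) (gauss r (suc z))) K
      ≡⟨ cong₂ _+_ (trans (cong (λ t → shift t (gauss r z) K) (*-suc c z))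
                          (sym (shift-shift c (c * z) (gauss r z) K)))
                   (trans (shift-shift (c * suc z) (suc z) (gauss r (suc z)) K)
                          (cong (λ t → shift t (gauss r (suc z)) K) (+-comm (c * suc z) (suc z)))) ⟩
    shift c (shift (c * z) (gauss r z)) K + shift (suc c * suc z) (gauss r (suc z)) K ∎
  last : δ 0 K + rest ≡ gaussPowerSum r (suc c) K
  last = begin
    δ 0 K + rest ≡⟨ cong (_+ rest) (trans (sym (gauss-0 r K))
        (cong (λ t → shift t (gauss r 0) K) (sym (*-zeroʳ (suc c))))) ⟩
    shift (suc c * 0) (gauss r 0) K + rest ≡⟨ sumRange-unfoldˡ (suc r) (λ z → shift (suc c * z) (gauss r z) K) ⟨
    gaussPowerSum r (suc c) K + shift (suc c * suc r) (gauss r (suc r)) K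
      ≡⟨ cong (gaussPowerSum r (suc c) K +_)
        (trans (shift-cong (suc c * suc r) (gauss-above r (suc r) ≤-refl) K) (shift-zero (suc c * suc r) K)) ⟩
    gaussPowerSum r (suc c) K + 0 ≡⟨ +-identityʳ _ ⟩
    gaussPowerSum r (suc c) K ∎

gaussSum≡gaussPowerSum : ∀ m K → gaussSum m m K ≡ gaussPowerSum m 0 K
gaussSum≡gaussPowerSum m K = go m
  where
  go : ∀ t → gaussSum m t K ≡ sumRange (suc t) (λ z → gauss m z K)
  go zero = refl
  go (suc t) = trans (gaussSum-suc m t K) (trans (cong (gauss m (suc t) K +_) (go t)) (+-comm (gauss m (suc t) K) _))

module OnesAndRecordsSum (N : ℕ) where

  continuations : ℕ → ℕ → Series
  continuations r M K = sumWords N r (λ u → when (onesAndRecords M u) (δ (lbFrom M u) K))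

  continuations-start : ∀ r K → 0 < N → continuations (suc r) 0 K ≡ continuations r 1 K
  continuations-start r K 0<N = begin
    continuations (suc r) 0 K ≡⟨ sumWords-∷ r _ ⟩
    sumRange N (λ i → sumWords N r (λ w → when (onesAndRecords 0 (suc i ∷ w)) (δ (lbFrom 0 (suc i ∷ w)) K)))
      ≡⟨ sumRange-cong N (λ i _ → trans (sumWords-cong r (λ w _ → first-letter i w)) (sumWords-when r (i ≡ᵇ 0) _)) ⟩
    sumRange N (λ i → when (i ≡ᵇ 0) (continuations r 1 K)) ≡⟨ sumRange-pick N 0 _ 0<N ⟩
    continuations r 1 K ∎
    where
    first-letter : ∀ i w → when (onesAndRecords 0 (suc i ∷ w)) (δ (lbFrom 0 (suc i ∷ w)) K)
                         ≡ when (i ≡ᵇ 0) (when (onesAndRecords 1 w) (δ (lbFrom 1 w) K))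
    first-letter zero w = refl
    first-letter (suc i) w = refl

  continuations-suc : ∀ r M K → 1 ≤ M → M < N →
    continuations (suc r) M K ≡ shift (M ∸ 1) (continuations r M) K + continuations r (suc M) K
  continuations-suc r M K 1≤M M<N = begin
    continuations (suc r) M K ≡⟨ sumWords-∷ r _ ⟩
    sumRange N (λ i → sumWords N r (λ w → when (onesAndRecords M (suc i ∷ w)) (δ (lbFrom M (suc i ∷ w)) K)))
      ≡⟨ sumRange-cong N (λ i _ → trans (sumWords-cong r (λ w _ → next-letter i w)) (sumWords-+ r _ _)) ⟩
    sumRange N (λ i → sumWords N r (λ w → when (i ≡ᵇ 0) (addOne w))
                      + sumWords N r (λ w → when (i ≡ᵇ M) (addRecord w)))
      ≡⟨ sumRange-+ N _ _ ⟩
    sumRange N (λ i → sumWords N r (λ w → when (i ≡ᵇ 0) (addOne w)))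
      + sumRange N (λ i → sumWords N r (λ w → when (i ≡ᵇ M) (addRecord w)))
      ≡⟨ cong₂ _+_
           (trans (sumRange-cong N (λ i _ → trans (sumWords-when r (i ≡ᵇ 0) addOne)
                                                  (cong (when (i ≡ᵇ 0)) (sumWords-shift r (M ∸ 1) _ K))))
                  (sumRange-pick N 0 _ (<-≤-trans 1≤M (<⇒≤ M<N))))
           (trans (sumRange-cong N (λ i _ → sumWords-when r (i ≡ᵇ M) addRecord)) (sumRange-pick N M _ M<N)) ⟩
    shift (M ∸ 1) (continuations r M) K + continuations r (suc M) K ∎
    where
    addOne addRecord : Word → ℕ
    addOne w = shift (M ∸ 1) (λ K′ → when (onesAndRecords M w) (δ (lbFrom M w) K′)) K
    addRecord w = when (onesAndRecords (suc M) w) (δ (lbFrom (suc M) w) K)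

    next-letter : ∀ i w → when (onesAndRecords M (suc i ∷ w)) (δ (lbFrom M (suc i ∷ w)) K)
                          ≡ when (i ≡ᵇ 0) (addOne w) + when (i ≡ᵇ M) (addRecord w)
    next-letter zero w rewrite ≡ᵇ-false {0} {M} (<⇒≢ 1≤M) | m≥n⇒m⊔n≡m 1≤M = begin
      when (onesAndRecords M w) (δ ((M ∸ 1) + lbFrom M w) K)
        ≡⟨ cong (when (onesAndRecords M w)) (shift-δ (M ∸ 1) (lbFrom M w) K) ⟨
      when (onesAndRecords M w) (shift (M ∸ 1) (δ (lbFrom M w)) K) ≡⟨ when-shift (onesAndRecords M w) (M ∸ 1) _ K ⟩
      addOne w ≡⟨ +-identityʳ _ ⟨
      addOne w + 0 ∎
    next-letter (suc i) w with suc i ≡ᵇ M in i+1≡M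
    ... | false = refl
    ... | true with refl ← ≡ᵇ-true⁻¹ {suc i} {M} i+1≡M
      rewrite m≤n⇒m∸n≡0 (n≤1+n (suc i)) | m≤n⇒m⊔n≡n (n≤1+n (suc i)) = refl

  continuations-closed : ∀ r c → suc c + r ≤ N → ∀ K → continuations r (suc c) K ≡ gaussPowerSum r c K
  continuations-closed zero c _ K = begin
    continuations 0 (suc c) K ≡⟨ sumWords-[] {N} (λ u → when (onesAndRecords (suc c) u) (δ (lbFrom (suc c) u) K)) ⟩
    δ 0 K ≡⟨ coeff-one K ⟨
    gauss 0 0 K ≡⟨ cong (λ t → shift t (gauss 0 0) K) (*-zeroʳ c) ⟨
    shift (c * 0) (gauss 0 0) K ∎
  continuations-closed (suc r) c 1+c+1+r≤N K = begin
    continuations (suc r) (suc c) K ≡⟨ continuations-suc r (suc c) K (s≤s z≤n)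
        (<-≤-trans (s≤s (s≤s (m≤m+n c r))) 2+c+r≤N) ⟩
    shift c (continuations r (suc c)) K + continuations r (suc (suc c)) K
      ≡⟨ cong₂ _+_ (shift-cong c (continuations-closed r c (≤-trans (n≤1+n _) 2+c+r≤N)) K)
        (continuations-closed r (suc c) 2+c+r≤N K) ⟩
    shift c (gaussPowerSum r c) K + gaussPowerSum r (suc c) K ≡⟨ gaussPowerSum-suc r c K ⟨
    gaussPowerSum (suc r) c K ∎
    where
    2+c+r≤N : suc (suc c) + r ≤ N
    2+c+r≤N = subst (_≤ N) (+-suc (suc c) r) 1+c+1+r≤N

coeff-genPoly-avoiders : ∀ (stat : Word → ℕ) n v K →
  coeff (genPoly stat (Ravoid n v)) K ≡ sumWords n n (λ w → when (isRGF w ∧ avoids w v) (δ (stat w) K))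
coeff-genPoly-avoiders stat n v K = begin
  coeff (genPoly stat (Ravoid n v)) K ≡⟨ coeff-genPoly stat (Ravoid n v) K ⟩
  sumList (filterᵇ (λ w → avoids w v) (R n)) (λ w → δ (stat w) K) ≡⟨ sumList-filterᵇ _ (R n) _ ⟩
  sumList (R n) (λ w → when (avoids w v) (δ (stat w) K)) ≡⟨ sumList-filterᵇ isRGF (words n n) _ ⟩
  sumWords n n (λ w → when (isRGF w) (when (avoids w v) (δ (stat w) K)))
    ≡⟨ sumList-cong (words n n) (λ w → when-∧ (isRGF w) _ _) ⟨
  sumWords n n (λ w → when (isRGF w ∧ avoids w v) (δ (stat w) K)) ∎

module _ (v : Word) (avoider : Word → Bool) (avoider-iff : ∀ w → isRGF w ∧ avoids w v ≡ avoider w) (n K : ℕ) where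

  coeff-LB : coeff (LB n v) K ≡ sumWords n n (λ w → when (avoider w) (δ (lbFrom 0 w) K))
  coeff-LB = trans (coeff-genPoly-avoiders lb n v K) (sumList-cong (words n n) term)
    where
    term : ∀ w → when (isRGF w ∧ avoids w v) (δ (lb w) K) ≡ when (avoider w) (δ (lbFrom 0 w) K)
    term w with isRGF w in rgf | avoider-iff w
    ... | false | iff rewrite sym iff = refl
    ... | true | iff rewrite sym iff | lb≡lbFrom w rgf = refl

  coeff-RS : coeff (RS n v) K ≡ sumWords n n (λ w → when (avoider w) (δ (rs w) K))
  coeff-RS = trans (coeff-genPoly-avoiders rs n v K)
      (sumList-cong (words n n) (λ w → cong (λ b → when b (δ (rs w) K)) (avoider-iff w)))

lbFrom-rise : ∀ k w → lbFrom k (suc k ∷ w) ≡ lbFrom (suc k) w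
lbFrom-rise k w rewrite m≤n⇒m∸n≡0 (n≤1+n k) | m≤n⇒m⊔n≡n (n≤1+n k) = refl

LB-112 : ∀ m K → coeff (LB (suc m) w112) K ≡ gaussSum m m K
LB-112 m K = begin
  coeff (LB (suc m) w112) K
    ≡⟨ coeff-LB w112 (risesThenDescends 0) isRGF∧avoids-112≡risesThenDescends (suc m) K ⟩
  continuations (suc m) 0 K ≡⟨ continuations-top m refl K ⟩
  gaussSum m m K ∎
  where
  open RisesThenDescendsSum (suc m) lbFrom (λ _ → refl) lbFrom-rise
    (λ k k≤N → descendingSum-lbCost (suc m) k k≤N (lbFrom k) refl (λ v z → lbFrom-∷ʳ k k v z ≤-refl))

RS-112 : ∀ m K → coeff (RS (suc m) w112) K ≡ gaussSum m m K
RS-112 m K = begin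
  coeff (RS (suc m) w112) K
    ≡⟨ coeff-RS w112 (risesThenDescends 0) isRGF∧avoids-112≡risesThenDescends (suc m) K ⟩
  continuations (suc m) 0 K ≡⟨ continuations-top m refl K ⟩
  gaussSum m m K ∎
  where
  rs-after : ℕ → Word → ℕ
  rs-after k u = rs (oneTo k ++ u)
  rs-after-[] : ∀ k → rs-after k [] ≡ 0
  rs-after-[] k = trans (cong rs (++-identityʳ (oneTo k))) (rs-oneTo k)
  open RisesThenDescendsSum (suc m) rs-after rs-after-[] (λ k w → cong rs (sym (++-assoc (oneTo k) [ suc k ] w)))
    (λ k k≤N → descendingSum-rsCost (suc m) k k≤N (rs-after k) (rs-after-[] k) (rs-oneTo-∷ʳ k))

LB-122 : ∀ m K → coeff (LB (suc m) w122) K ≡ gaussSum m m K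
LB-122 m K = begin
  coeff (LB (suc m) w122) K ≡⟨ coeff-LB w122 (onesAndRecords 0) isRGF∧avoids-122≡onesAndRecords (suc m) K ⟩
  continuations (suc m) 0 K ≡⟨ continuations-start m K z<s ⟩
  continuations m 1 K ≡⟨ continuations-closed m 0 ≤-refl K ⟩
  gaussPowerSum m 0 K ≡⟨ gaussSum≡gaussPowerSum m K ⟨
  gaussSum m m K ∎
  where open OnesAndRecordsSum (suc m)

theorem2p1 : (m : ℕ) → let n = suc m in
    (LB n w112 ≈P sumQbinom m m) × (RS n w112 ≈P sumQbinom m m) × (LB n w122 ≈P sumQbinom m m)
theorem2p1 m = LB-112 m , RS-112 m , LB-122 m
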